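{- Let $s_k,t_k$ be elements of a commutative ring and $r_k=1$ for all $k\ge0$, with associated Catalan-Stieltjes matrix $(c_{i,j})$. Fix $n\ge1$ and equip $D^{C_n}$ with weights as described (each block Type chosen independently among the applicable ones). Form the digraph $\tilde D$ consisting of: $D^{C_n}$; a disjoint copy $\bar D$ of $D^{C_n}$ with every arc reversed (vertex $v$ of $D^{C_n}$ corresponds to $\bar v$, and each arc $u\to v$ of $D^{C_n}$ gives an arc $\bar v\to\bar u$ of the same weight); and arcs $P_i^{(n)}\to\bar P_i^{(n)}$ of weight $t_1t_2\cdots t_{n-i}$ for $0\le i\le n$ (empty product $=1$). Then for all $0\le i,j\le n$, $$c_{i+j,0}=GF_{\tilde D}\big(P_{n-i}^{(0)},\bar P_{n-j}^{(0)}\big).$$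
   Context: The Catalan-Stieltjes matrix $(c_{i,j})_{i,j\ge0}$ is lower triangular with $c_{0,0}=1$, $c_{i,0}=s_0c_{i-1,0}+t_1c_{i-1,1}$ and $c_{i,j}=r_{j-1}c_{i-1,j-1}+s_jc_{i-1,j}+t_{j+1}c_{i-1,j+1}$ for $i,j\ge1$; conventions $r_{ -1}=t_0=0$. For $m\ge0$ the block $D^{L_m}$ has vertices $P_i^{(m)},Q_i^{(m)},P_i^{(m+1)}$ ($0\le i\le m+1$) and arcs $P_k^{(m)}\to Q_k^{(m)}$, $Q_k^{(m)}\to P_k^{(m+1)}$ ($0\le k\le m+1$), and $P_k^{(m)}\to Q_{k+1}^{(m)}$, $Q_k^{(m)}\to P_{k+1}^{(m+1)}$, $P_k^{(m)}\to P_{k+1}^{(m+1)}$ ($0\le k\le m$). $D^{C_n}$ is the union of $D^{L_0},\dots,D^{L_{n-1}}$ (same-named vertices identified) plus connecting arcs $P_i^{(m)}\to P_i^{(m+1)}$ for $0\le m\le n-1$, $m+2\le i\le n$, of weight $1$. Each block $D^{L_m}$ is weighted by one of the following Types (for $0\le k\le m$ unless stated; unlisted block arcs weight $1$; Type 5 only if there exist ring elements $b_k,c_k$ with $s_k=b_k+c_k$, $t_{k+1}=b_{k+1}c_k$ for all $k$): Type 1: $P_k^{(m)}\to Q_k^{(m)}$: $r_{m-k}$; $P_k^{(m)}\to Q_{k+1}^{(m)}$: $t_{m-k}$; $P_k^{(m)}\to P_{k+1}^{(m+1)}$: $s_{m-k}-r_{m-k}-t_{m-k}$. Type 2: $Q_k^{(m)}\to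 P_k^{(m+1)}$: $r_{m-k}$; $Q_k^{(m)}\to P_{k+1}^{(m+1)}$: $t_{m-k+1}$; $P_k^{(m)}\to P_{k+1}^{(m+1)}$: $s_{m-k}-r_{m-k-1}-t_{m-k+1}$; $P_m^{(m)}\to Q_{m+1}^{(m)}$: $0$. Type 3: $Q_k^{(m)}\to P_k^{(m+1)}$: $r_{m-k}$; $P_k^{(m)}\to Q_{k+1}^{(m)}$: $t_{m-k}$; $P_k^{(m)}\to P_{k+1}^{(m+1)}$: $s_{m-k}-r_{m-k-1}t_{m-k}-1$. Type 4: $P_k^{(m)}\to Q_k^{(m)}$: $r_{m-k}$; $Q_k^{(m)}\to P_{k+1}^{(m+1)}$: $t_{m-k+1}$; $P_k^{(m)}\to P_{k+1}^{(m+1)}$: $s_{m-k}-r_{m-k}t_{m-k+1}-1$ ($0\le k\le m-1$); $P_m^{(m)}\to P_{m+1}^{(m+1)}$: $s_0-r_0t_1$; $P_m^{(m)}\to Q_{m+1}^{(m)}$: $0$. Type 5: $P_k^{(m)}\to Q_{k+1}^{(m)}$: $b_{m-k}$; $Q_k^{(m)}\to P_{k+1}^{(m+1)}$: $c_{m-k}$; $P_k^{(m)}\to P_{k+1}^{(m+1)}$: $0$. $GF_D(u,v)$ is the sum over directed paths in $D$ from $u$ to $v$ of the product of arc weights. -}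

module Defs where

open import Level using (_⊔_)
open import Algebra.Bundles using (CommutativeRing)
open import Data.Nat using (ℕ; zero; suc; _∸_; _≤ᵇ_; _≡ᵇ_) renaming (_+_ to _+ℕ_)
import Data.Nat as ℕ
open import Data.Bool using (Bool; true; false; if_then_else_)
open import Data.List using (List; []; _∷_; [_]; map; concatMap; upTo; length; foldr; applyUpTo)
open import Data.Product using (_×_; _,_)
open import Data.Unit.Polymorphic using (⊤)
open import Relation.Nullary using (Dec; yes; no; does)
open import Relation.Binary.PropositionalEquality using (_≡_; refl; cong; cong₂)

-- Vertices.  P m i = P_i^{(m)},  Q m i = Q_i^{(m)}  (superscript first).

data V : Set where
  P : ℕ → ℕ → V
  Q : ℕ → ℕ → V

data VT : Set where
  orig : V → VT
  bar  : V → VT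

_≟V_ : (u v : V) → Dec (u ≡ v)
P m i ≟V P m' i' with m ℕ.≟ m' | i ℕ.≟ i'
... | yes refl | yes refl = yes refl
... | no ne | _ = no λ { refl → ne refl }
... | yes _ | no ne = no λ { refl → ne refl }
P _ _ ≟V Q _ _ = no λ ()
Q _ _ ≟V P _ _ = no λ ()
Q m i ≟V Q m' i' with m ℕ.≟ m' | i ℕ.≟ i'
... | yes refl | yes refl = yes refl
... | no ne | _ = no λ { refl → ne refl }
... | yes _ | no ne = no λ { refl → ne refl }

_≟VT_ : (u v : VT) → Dec (u ≡ v)
orig u ≟VT orig v with u ≟V v
... | yes refl = yes refl
... | no ne = no λ { refl → ne refl }
orig _ ≟VT bar _ = no λ ()
bar _ ≟VT orig _ = no λ ()
bar u ≟VT bar v with u ≟V v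
... | yes refl = yes refl
... | no ne = no λ { refl → ne refl }

range : ℕ → ℕ → List ℕ
range a b = applyUpTo (λ x → a +ℕ x) (b ∸ a)

module CS {a ℓ} (R : CommutativeRing a ℓ) where
  open CommutativeRing R

  r : ℕ → Carrier
  r _ = 1#

  -- r₋₁ j = r_{j-1}, with the convention r_{-1} = 0
  r₋₁ : ℕ → Carrier
  r₋₁ zero    = 0#
  r₋₁ (suc j) = r j

  -- the sequence t with the convention t_0 = 0
  tz : (ℕ → Carrier) → ℕ → Carrier
  tz t zero    = 0#
  tz t (suc k) = t (suc k)

  catalan : (s t : ℕ → Carrier) → ℕ → ℕ → Carrier
  catalan s t zero zero    = 1#
  catalan s t zero (suc j) = 0#
  catalan s t (suc i) zero =
    s 0 * catalan s t i 0 + t 1 * catalan s t i 1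
  catalan s t (suc i) (suc j) =
    r j * catalan s t i j + s (suc j) * catalan s t i (suc j)
      + t (suc (suc j)) * catalan s t i (suc (suc j))

  data BlockType : Set a where
    type1 type2 type3 type4 : BlockType
    type5 : (b c : ℕ → Carrier) → BlockType

  Applicable : (s t : ℕ → Carrier) → BlockType → Set ℓ
  Applicable s t (type5 b c) =
    ((k : ℕ) → s k ≈ b k + c k) × ((k : ℕ) → t (suc k) ≈ b (suc k) * c k)
  Applicable s t type1 = ⊤
  Applicable s t type2 = ⊤
  Applicable s t type3 = ⊤
  Applicable s t type4 = ⊤

  record Arc : Set a where
    constructor arc
    field
      src : VT
      tgt : VT
      wt  : Carrier
  open Arc public

  module Weights (s t : ℕ → Carrier) where

    -- P_k^{(m)} → Q_k^{(m)},  0 ≤ k ≤ m+1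
    wPQ : BlockType → ℕ → ℕ → Carrier
    wPQ type1 m k = if k ≤ᵇ m then r (m ∸ k) else 1#
    wPQ type4 m k = if k ≤ᵇ m then r (m ∸ k) else 1#
    wPQ _     m k = 1#

    -- Q_k^{(m)} → P_k^{(m+1)},  0 ≤ k ≤ m+1
    wQP : BlockType → ℕ → ℕ → Carrier
    wQP type2 m k = if k ≤ᵇ m then r (m ∸ k) else 1#
    wQP type3 m k = if k ≤ᵇ m then r (m ∸ k) else 1#
    wQP _     m k = 1#

    -- P_k^{(m)} → Q_{k+1}^{(m)},  0 ≤ k ≤ m
    wPQ' : BlockType → ℕ → ℕ → Carrier
    wPQ' type1       m k = tz t (m ∸ k)
    wPQ' type2       m k = if k ≡ᵇ m then 0# else 1#
    wPQ' type3       m k = tz t (m ∸ k)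
    wPQ' type4       m k = if k ≡ᵇ m then 0# else 1#
    wPQ' (type5 b c) m k = b (m ∸ k)

    -- Q_k^{(m)} → P_{k+1}^{(m+1)},  0 ≤ k ≤ m
    wQP' : BlockType → ℕ → ℕ → Carrier
    wQP' type1       m k = 1#
    wQP' type2       m k = t (suc (m ∸ k))
    wQP' type3       m k = 1#
    wQP' type4       m k = t (suc (m ∸ k))
    wQP' (type5 b c) m k = c (m ∸ k)

    -- P_k^{(m)} → P_{k+1}^{(m+1)},  0 ≤ k ≤ m
    wPP : BlockType → ℕ → ℕ → Carrier
    wPP type1       m k = s (m ∸ k) - r (m ∸ k) - tz t (m ∸ k)
    wPP type2       m k = s (m ∸ k) - r₋₁ (m ∸ k) - t (suc (m ∸ k))
    wPP type3       m k = s (m ∸ k) - r₋₁ (m ∸ k) * tz t (m ∸ k) - 1#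
    wPP type4       m k =
      if k ≡ᵇ m then s 0 - r 0 * t 1
                else s (m ∸ k) - r (m ∸ k) * t (suc (m ∸ k)) - 1#
    wPP (type5 b c) m k = 0#

    blockArcs : BlockType → ℕ → List Arc
    blockArcs bt m =
      concatMap (λ k →
          arc (orig (P m k)) (orig (Q m k)) (wPQ bt m k)
        ∷ arc (orig (Q m k)) (orig (P (suc m) k)) (wQP bt m k)
        ∷ []) (upTo (suc (suc m)))
      Data.List.++
      concatMap (λ k →
          arc (orig (P m k)) (orig (Q m (suc k))) (wPQ' bt m k)
        ∷ arc (orig (Q m k)) (orig (P (suc m) (suc k))) (wQP' bt m k)
        ∷ arc (orig (P m k)) (orig (P (suc m) (suc k))) (wPP bt m k)
        ∷ []) (upTo (suc m))

    connArcs : ℕ → ℕ → List Arc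
    connArcs n m =
      map (λ i → arc (orig (P m i)) (orig (P (suc m) i)) 1#) (range (suc (suc m)) (suc n))

    DCArcs : ℕ → (ℕ → BlockType) → List Arc
    DCArcs n ty = concatMap (λ m → blockArcs (ty m) m Data.List.++ connArcs n m) (upTo n)

    barV : VT → VT
    barV (orig v) = bar v
    barV (bar v)  = orig v

    tprod : ℕ → Carrier
    tprod zero    = 1#
    tprod (suc k) = tprod k * t (suc k)

    tildeArcs : ℕ → (ℕ → BlockType) → List Arc
    tildeArcs n ty =
      DCArcs n ty
      Data.List.++ map (λ e → arc (barV (tgt e)) (barV (src e)) (wt e)) (DCArcs n ty)
      Data.List.++ map (λ i → arc (orig (P n i)) (bar (P n i)) (tprod (n ∸ i))) (upTo (suc n))

  walks : List Arc → ℕ → VT → VT → List (List Arc)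
  walks A zero    u v = if does (u ≟VT v) then [ [] ] else []
  walks A (suc L) u v =
    concatMap (λ e → if does (src e ≟VT u) then map (e ∷_) (walks A L (tgt e) v) else []) A

  weight : List Arc → Carrier
  weight = foldr (λ e w → wt e * w) 1#

  sumC : List Carrier → Carrier
  sumC = foldr _+_ 0#

  -- For an acyclic
  -- digraph (as D̃ is) walks are exactly directed paths, and every path
  -- uses distinct arcs, so this ranges over all directed paths u ⇝ v.
  GF : List Arc → VT → VT → Carrier
  GF A u v = sumC (concatMap (λ L → map weight (walks A L u v)) (upTo (suc (length A))))

-- D̃ is acyclic, so u ↦ GF(u, v) for v = P̄_b^{(0)}, b = n − j, is the unique function G
-- with G v = 1 and G u = Σ_{arcs u → w} wt · G w for u ≠ v; it suffices to exhibit one.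
-- Since r = 1, block D^{L_m} performs one step of a weighted Motzkin path at height m − k:
-- an up step of weight 1, level steps of total weight s_{m−k}, a down step of weight t_{m−k}.
-- Read backwards from v, the bar copy therefore gives G(P̄_k^{(m)}) = c_{m−b,m−k}, the crossing
-- arc turns this into t_1⋯t_{n−k} c_{j,n−k} at P_k^{(n)}, and on the original copy
-- G(P_k^{(m)}) = t_1⋯t_{m−k} c_{n−m+j,m−k}, because the rescaled matrix t_1⋯t_a c_{N,a}
-- satisfies the transposed Catalan–Stieltjes recurrence.  At P_{n−i}^{(0)} this is c_{i+j,0}.

{-# OPTIONS --safe #-}
module Submission where

open import Defs
open import Algebra.Bundles using (CommutativeRing)
open import Data.Nat using (ℕ; _∸_; _≤_; _<_) renaming (_+_ to _+ℕ_)
open import Data.Nat using (zero; suc; z≤n; s≤s; z<s; s<s; _≤ᵇ_; _≡ᵇ_)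
import Data.Nat.Properties as ℕ
open import Data.Bool using (true; false; if_then_else_)
open import Data.Bool.Properties using (T-≡; ¬-not)
open import Data.Empty using (⊥; ⊥-elim)
open import Data.List using (List; []; _∷_; _++_; map; concatMap; applyUpTo; upTo; length)
import Data.List.Properties as List
open import Data.List.Relation.Unary.All as All using (All; []; _∷_)
open import Data.List.Relation.Unary.All.Properties using (++⁺; concat⁺; map⁺; applyUpTo⁺₁)
open import Data.Product using (_×_; _,_)
open import Data.Sum using (inj₁; inj₂)
open import Function using (_∘_; id)
open import Function.Bundles using (Equivalence)
open import Relation.Binary.Definitions using (tri<; tri≈; tri>)
open import Relation.Binary.PropositionalEquality as ≡ using (_≡_; _≢_; cong)
open import Relation.Nullary using (Dec; does; yes; no)
import Algebra.Solver.Ring.NaturalCoefficients.Default as SemiringSolver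

double : ℕ → ℕ
double zero    = zero
double (suc m) = suc (suc (double m))

∸-suc : ∀ {k m} → k < m → m ∸ k ≡ suc (m ∸ suc k)
∸-suc (s≤s k≤m) = ℕ.+-∸-assoc 1 k≤m

≤ᵇ-true : ∀ {k m} → k ≤ m → (k ≤ᵇ m) ≡ true
≤ᵇ-true = Equivalence.to T-≡ ∘ ℕ.≤⇒≤ᵇ

≤ᵇ-false : ∀ {k m} → m < k → (k ≤ᵇ m) ≡ false
≤ᵇ-false m<k = ¬-not (ℕ.<⇒≱ m<k ∘ ℕ.≤ᵇ⇒≤ _ _ ∘ Equivalence.from T-≡)

≡ᵇ-true : ∀ k → (k ≡ᵇ k) ≡ true
≡ᵇ-true k = Equivalence.to T-≡ (ℕ.≡⇒≡ᵇ k k ≡.refl)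

≡ᵇ-false : ∀ {k m} → k ≢ m → (k ≡ᵇ m) ≡ false
≡ᵇ-false k≢m = ¬-not (k≢m ∘ ℕ.≡ᵇ⇒≡ _ _ ∘ Equivalence.from T-≡)

x<N∸a⇒a+x<N : ∀ a {x N} → x < N ∸ a → a +ℕ x < N
x<N∸a⇒a+x<N zero    {N = N}     x<N   = x<N
x<N∸a⇒a+x<N (suc a) {N = suc N} x<N∸a = s<s (x<N∸a⇒a+x<N a x<N∸a)

module FiniteSums {a ℓ} (R : CommutativeRing a ℓ) where
  open CommutativeRing R
  open CS R
  open import Algebra.Properties.CommutativeSemigroup +-commutativeSemigroup using (interchange)

  ∑∈ : ∀ {x} {X : Set x} → List X → (X → Carrier) → Carrier
  ∑∈ xs f = sumC (map f xs)

  sumC-++ : ∀ xs ys → sumC (xs ++ ys) ≈ sumC xs + sumC ys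
  sumC-++ []       ys = sym (+-identityˡ _)
  sumC-++ (x ∷ xs) ys = trans (+-congˡ (sumC-++ xs ys)) (sym (+-assoc _ _ _))

  sumC-concatMap : ∀ {x} {X : Set x} (xs : List X) F → sumC (concatMap F xs) ≈ ∑∈ xs (sumC ∘ F)
  sumC-concatMap []       F = refl
  sumC-concatMap (x ∷ xs) F = trans (sumC-++ (F x) _) (+-congˡ (sumC-concatMap xs F))

  ∑∈-++ : ∀ {x} {X : Set x} (xs ys : List X) f → ∑∈ (xs ++ ys) f ≈ ∑∈ xs f + ∑∈ ys f
  ∑∈-++ xs ys f = trans (reflexive (cong sumC (List.map-++ f xs ys))) (sumC-++ (map f xs) _)

  ∑∈-concatMap : ∀ {x y} {X : Set x} {Y : Set y} (xs : List X) (F : X → List Y) f →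
                 ∑∈ (concatMap F xs) f ≈ ∑∈ xs (λ x → ∑∈ (F x) f)
  ∑∈-concatMap xs F f = trans (reflexive (cong sumC (List.map-concatMap f F xs))) (sumC-concatMap xs _)

  ∑∈-map : ∀ {x y} {X : Set x} {Y : Set y} (g : X → Y) xs f → ∑∈ (map g xs) f ≡ ∑∈ xs (f ∘ g)
  ∑∈-map g xs f = cong sumC (≡.sym (List.map-∘ xs))

  ∑∈-cong : ∀ {x} {X : Set x} {xs : List X} {f g} → All (λ x → f x ≈ g x) xs → ∑∈ xs f ≈ ∑∈ xs g
  ∑∈-cong []            = refl
  ∑∈-cong (fx≈gx ∷ eqs) = +-cong fx≈gx (∑∈-cong eqs)

  ∑∈-vanish : ∀ {x} {X : Set x} {xs : List X} {f} → All (λ x → f x ≈ 0#) xs → ∑∈ xs f ≈ 0#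
  ∑∈-vanish []          = refl
  ∑∈-vanish (fx≈0 ∷ zs) = trans (+-cong fx≈0 (∑∈-vanish zs)) (+-identityʳ 0#)

  ∑∈-+ : ∀ {x} {X : Set x} (xs : List X) f g → ∑∈ xs (λ x → f x + g x) ≈ ∑∈ xs f + ∑∈ xs g
  ∑∈-+ []       f g = sym (+-identityʳ 0#)
  ∑∈-+ (x ∷ xs) f g = trans (+-congˡ (∑∈-+ xs f g)) (interchange _ _ _ _)

  *-∑∈ : ∀ {x} {X : Set x} c (xs : List X) f → c * ∑∈ xs f ≈ ∑∈ xs (λ x → c * f x)
  *-∑∈ c []       f = zeroʳ c
  *-∑∈ c (x ∷ xs) f = trans (distribˡ c _ _) (+-congˡ (*-∑∈ c xs f))

  -- Opaque, so that ∑< (suc N) f does not unfold and f stays inferable.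
  opaque
    ∑< : ℕ → (ℕ → Carrier) → Carrier
    ∑< N f = sumC (applyUpTo f N)

    ∑<-zero : ∀ f → ∑< 0 f ≡ 0#
    ∑<-zero f = ≡.refl

    ∑<-suc : ∀ N f → ∑< (suc N) f ≡ f 0 + ∑< N (f ∘ suc)
    ∑<-suc N f = ≡.refl

    ∑<-cong : ∀ N {f g : ℕ → Carrier} → (∀ k → k < N → f k ≈ g k) → ∑< N f ≈ ∑< N g
    ∑<-cong zero    f≈g = refl
    ∑<-cong (suc N) f≈g = +-cong (f≈g 0 z<s) (∑<-cong N (λ k k<N → f≈g (suc k) (s<s k<N)))

    ∑<-vanish : ∀ N {f : ℕ → Carrier} → (∀ k → k < N → f k ≈ 0#) → ∑< N f ≈ 0#
    ∑<-vanish zero    f≈0 = refl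
    ∑<-vanish (suc N) f≈0 =
      trans (+-cong (f≈0 0 z<s) (∑<-vanish N (λ k k<N → f≈0 (suc k) (s<s k<N)))) (+-identityʳ 0#)

    ∑<-single : ∀ N {f : ℕ → Carrier} k₀ → k₀ < N → (∀ k → k < N → k ≢ k₀ → f k ≈ 0#) →
                ∑< N f ≈ f k₀
    ∑<-single (suc N) zero     _           f≈0 =
      trans (+-congˡ (∑<-vanish N (λ k k<N → f≈0 (suc k) (s<s k<N) (λ ())))) (+-identityʳ _)
    ∑<-single (suc N) (suc k₀) (s<s k₀<N) f≈0 =
      trans (+-congʳ (f≈0 0 z<s (λ ())))
        (trans (+-identityˡ _)
          (∑<-single N k₀ k₀<N (λ k k<N k≢k₀ → f≈0 (suc k) (s<s k<N) (k≢k₀ ∘ ℕ.suc-injective))))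

    ∑<-+ : ∀ N (f g : ℕ → Carrier) → ∑< N (λ k → f k + g k) ≈ ∑< N f + ∑< N g
    ∑<-+ zero    f g = sym (+-identityʳ 0#)
    ∑<-+ (suc N) f g = trans (+-congˡ (∑<-+ N (f ∘ suc) (g ∘ suc))) (interchange _ _ _ _)

    ∑∈-applyUpTo : ∀ {x} {X : Set x} N (g : ℕ → X) f → ∑∈ (applyUpTo g N) f ≡ ∑< N (f ∘ g)
    ∑∈-applyUpTo N g f = cong sumC (List.map-applyUpTo g f N)

module WalkSums {a ℓ} (R : CommutativeRing a ℓ) where
  open CommutativeRing R
  open CS R
  open FiniteSums R
  open import Relation.Binary.Reasoning.Setoid setoid

  outTerm : (VT → Carrier) → VT → Arc → Carrier
  outTerm G u e = if does (src e ≟VT u) then wt e * G (tgt e) else 0#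

  outSum : List Arc → (VT → Carrier) → VT → Carrier
  outSum A G u = ∑∈ A (outTerm G u)

  outTerm-hit : ∀ G {u} e → src e ≡ u → outTerm G u e ≈ wt e * G (tgt e)
  outTerm-hit G {u} e src≡u with src e ≟VT u
  ... | yes _      = refl
  ... | no  src≢u  = ⊥-elim (src≢u src≡u)

  outTerm-miss : ∀ G {u} e → src e ≢ u → outTerm G u e ≈ 0#
  outTerm-miss G {u} e src≢u with src e ≟VT u
  ... | yes src≡u = ⊥-elim (src≢u src≡u)
  ... | no  _     = refl

  outSum-local : ∀ {p} {P : Arc → Set p} A {G H} u → All P A →
                 (∀ {e} → P e → src e ≡ u → G (tgt e) ≈ H (tgt e)) → outSum A G u ≈ outSum A H u
  outSum-local A {G} {H} u all agree = ∑∈-cong (All.map local all)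
    where
    local : ∀ {e} → _ → outTerm G u e ≈ outTerm H u e
    local {e} pe with src e ≟VT u
    ... | yes src≡u = *-congˡ (agree pe src≡u)
    ... | no  _     = refl

  outSum-cong : ∀ A {G H} u → (∀ w → G w ≈ H w) → outSum A G u ≈ outSum A H u
  outSum-cong A u G≈H = outSum-local A u (All.universal-U A) (λ _ _ → G≈H _)

  outSum-0 : ∀ A u → outSum A (λ _ → 0#) u ≈ 0#
  outSum-0 A u = ∑∈-vanish (All.universal vanish A)
    where
    vanish : ∀ e → outTerm (λ _ → 0#) u e ≈ 0#
    vanish e with src e ≟VT u
    ... | yes _ = zeroʳ (wt e)
    ... | no  _ = refl

  outSum-+ : ∀ A G H u → outSum A (λ w → G w + H w) u ≈ outSum A G u + outSum A H u
  outSum-+ A G H u = trans (∑∈-cong (All.universal split A)) (∑∈-+ A _ _)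
    where
    split : ∀ e → outTerm (λ w → G w + H w) u e ≈ outTerm G u e + outTerm H u e
    split e with src e ≟VT u
    ... | yes _ = distribˡ (wt e) _ _
    ... | no  _ = sym (+-identityʳ 0#)

  outSum-∑< : ∀ A N (G : ℕ → VT → Carrier) u →
              outSum A (λ w → ∑< N (λ l → G l w)) u ≈ ∑< N (λ l → outSum A (G l) u)
  outSum-∑< A zero    G u = trans (outSum-cong A u (λ _ → reflexive (∑<-zero _)))
                                   (trans (outSum-0 A u) (reflexive (≡.sym (∑<-zero _))))
  outSum-∑< A (suc N) G u = begin
    outSum A (λ w → ∑< (suc N) (λ l → G l w)) u
      ≈⟨ outSum-cong A u (λ _ → reflexive (∑<-suc N _)) ⟩
    outSum A (λ w → G 0 w + ∑< N (λ l → G (suc l) w)) u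
      ≈⟨ outSum-+ A (G 0) _ u ⟩
    outSum A (G 0) u + outSum A (λ w → ∑< N (λ l → G (suc l) w)) u
      ≈⟨ +-congˡ (outSum-∑< A N (G ∘ suc) u) ⟩
    outSum A (G 0) u + ∑< N (λ l → outSum A (G (suc l)) u)
      ≡⟨ ≡.sym (∑<-suc N _) ⟩
    ∑< (suc N) (λ l → outSum A (G l) u) ∎

  walkSum : List Arc → ℕ → VT → VT → Carrier
  walkSum A L u v = ∑∈ (walks A L u v) weight

  walkSum-refl : ∀ A u → walkSum A 0 u u ≈ 1#
  walkSum-refl A u with u ≟VT u
  ... | yes _   = +-identityʳ 1#
  ... | no  u≢u = ⊥-elim (u≢u ≡.refl)

  walkSum-≢ : ∀ A u v → u ≢ v → walkSum A 0 u v ≈ 0#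
  walkSum-≢ A u v u≢v with u ≟VT v
  ... | yes u≡v = ⊥-elim (u≢v u≡v)
  ... | no  _   = refl

  walkSum-suc : ∀ A L u v → walkSum A (suc L) u v ≈ outSum A (λ w → walkSum A L w v) u
  walkSum-suc A L u v = trans (∑∈-concatMap A _ weight) (∑∈-cong (All.universal firstArc A))
    where
    firstArc : ∀ e → ∑∈ (if does (src e ≟VT u) then map (e ∷_) (walks A L (tgt e) v) else []) weight
                     ≈ outTerm (λ w → walkSum A L w v) u e
    firstArc e with src e ≟VT u
    ... | yes _ = trans (reflexive (∑∈-map (e ∷_) (walks A L (tgt e) v) weight))
                        (sym (*-∑∈ (wt e) (walks A L (tgt e) v) weight))
    ... | no  _ = refl

  GF≈∑walkSum : ∀ A u v → GF A u v ≈ ∑< (suc (length A)) (λ L → walkSum A L u v)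
  GF≈∑walkSum A u v = trans (sumC-concatMap (upTo (suc (length A))) (λ L → map weight (walks A L u v)))
                            (reflexive (∑∈-applyUpTo (suc (length A)) id _))

  -- GF only sums walks of length at most length A; the rank bound rules out longer ones.
  module _ (A : List Arc) (v : VT) (rank : VT → ℕ) (Dom : VT → Set)
           (descends : All (λ e → Dom (tgt e) × rank (tgt e) < rank (src e)) A)
           (G : VT → Carrier)
           (G-eq : ∀ u → Dom u → G u ≈ walkSum A 0 u v + outSum A G u) where

    private
      walkSum≤ : ℕ → VT → Carrier
      walkSum≤ L u = ∑< (suc L) (λ l → walkSum A l u v)

      walkSum≤-suc : ∀ L u → walkSum≤ (suc L) u ≈ walkSum A 0 u v + outSum A (walkSum≤ L) u
      walkSum≤-suc L u = trans (reflexive (∑<-suc (suc L) _))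
        (+-congˡ (trans (∑<-cong (suc L) (λ l _ → walkSum-suc A l u v))
                        (sym (outSum-∑< A (suc L) (λ l w → walkSum A l w v) u))))

      walkSum≤-solution : ∀ L u → Dom u → rank u ≤ L → walkSum≤ L u ≈ G u
      walkSum≤-solution zero u u∈ rank≤0 = begin
        walkSum≤ 0 u                    ≡⟨ ≡.trans (∑<-suc 0 _) (cong (walkSum A 0 u v +_) (∑<-zero _)) ⟩
        walkSum A 0 u v + 0#            ≈⟨ +-congˡ (sym (outSum-0 A u)) ⟩
        walkSum A 0 u v + outSum A (λ _ → 0#) u ≈⟨ +-congˡ (outSum-local A u descends (λ {e} → noArc {e})) ⟩
        walkSum A 0 u v + outSum A G u  ≈⟨ sym (G-eq u u∈) ⟩
        G u                             ∎
        where
        noArc : ∀ {e} → Dom (tgt e) × rank (tgt e) < rank (src e) → src e ≡ u → 0# ≈ G (tgt e)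
        noArc (_ , lt) ≡.refl = ⊥-elim (ℕ.n≮0 (ℕ.≤-trans lt rank≤0))
      walkSum≤-solution (suc L) u u∈ rank≤ = begin
        walkSum≤ (suc L) u                       ≈⟨ walkSum≤-suc L u ⟩
        walkSum A 0 u v + outSum A (walkSum≤ L) u ≈⟨ +-congˡ (outSum-local A u descends (λ {e} → induct {e})) ⟩
        walkSum A 0 u v + outSum A G u           ≈⟨ sym (G-eq u u∈) ⟩
        G u                                      ∎
        where
        induct : ∀ {e} → Dom (tgt e) × rank (tgt e) < rank (src e) → src e ≡ u → walkSum≤ L (tgt e) ≈ G (tgt e)
        induct {e} (tgt∈ , lt) ≡.refl = walkSum≤-solution L (tgt e) tgt∈ (ℕ.≤-pred (ℕ.≤-trans lt rank≤))

    GF≈solution : ∀ u → Dom u → rank u ≤ length A → GF A u v ≈ G u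
    GF≈solution u u∈ rank≤ = trans (GF≈∑walkSum A u v) (walkSum≤-solution (length A) u u∈ rank≤)

module BlockWeights {a ℓ} (R : CommutativeRing a ℓ) (s t : ℕ → CommutativeRing.Carrier R) where
  open CommutativeRing R
  open CS R
  open Weights s t
  open SemiringSolver commutativeSemiring using (solve; _:=_; _:+_)
  open import Relation.Binary.Reasoning.Setoid setoid

  wPQ≈1 : ∀ bt m k → wPQ bt m k ≈ 1#
  wPQ≈1 type1       m k with k ≤ᵇ m
  ... | true  = refl
  ... | false = refl
  wPQ≈1 type2       m k = refl
  wPQ≈1 type3       m k = refl
  wPQ≈1 type4       m k with k ≤ᵇ m
  ... | true  = refl
  ... | false = refl
  wPQ≈1 (type5 _ _) m k = refl

  wQP≈1 : ∀ bt m k → wQP bt m k ≈ 1#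
  wQP≈1 type1       m k = refl
  wQP≈1 type2       m k with k ≤ᵇ m
  ... | true  = refl
  ... | false = refl
  wQP≈1 type3       m k with k ≤ᵇ m
  ... | true  = refl
  ... | false = refl
  wQP≈1 type4       m k = refl
  wQP≈1 (type5 _ _) m k = refl

  private
    cancel : ∀ p q y → p + q + (y - p - q) ≈ y
    cancel p q y = begin
      p + q + (y - p - q)
        ≈⟨ solve 5 (λ p q y p′ q′ → p :+ q :+ (y :+ p′ :+ q′) := y :+ (p :+ p′) :+ (q :+ q′))
                 refl p q y (- p) (- q) ⟩
      y + (p - p) + (q - q)
        ≈⟨ +-cong (+-congˡ (-‿inverseʳ p)) (-‿inverseʳ q) ⟩
      y + 0# + 0#
        ≈⟨ trans (+-identityʳ _) (+-identityʳ y) ⟩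
      y ∎

    cancel′ : ∀ p q y → p + q + (y - q - p) ≈ y
    cancel′ p q y = trans (+-congʳ (+-comm p q)) (cancel q p y)

    cancel₁ : ∀ p y → p + (y - p) ≈ y
    cancel₁ p y = trans (+-comm p (y - p)) (trans (+-assoc y (- p) p) (trans (+-congˡ (-‿inverseˡ p)) (+-identityʳ y)))

    [k≢m]≡r₋₁[m∸k] : ∀ {k m} → k ≤ m → (if k ≡ᵇ m then 0# else 1#) ≡ r₋₁ (m ∸ k)
    [k≢m]≡r₋₁[m∸k] {k} k≤m with ℕ.m≤n⇒m<n∨m≡n k≤m
    ... | inj₂ ≡.refl rewrite ≡ᵇ-true k | ℕ.n∸n≡0 k = ≡.refl
    ... | inj₁ k<m    rewrite ≡ᵇ-false (ℕ.<⇒≢ k<m) | ∸-suc k<m = ≡.refl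

    r₋₁*tz : ∀ x → r₋₁ x * tz t x ≈ tz t x
    r₋₁*tz zero    = zeroʳ 0#
    r₋₁*tz (suc x) = *-identityˡ _

  -- Total weights of the paths P_k^{(m)} ⇝ P_{k+1}^{(m+1)} (a level step) and
  -- P_k^{(m)} → Q_{k+1}^{(m)} → P_{k+2}^{(m+1)} (a down step).
  level-step-weight : ∀ bt → Applicable s t bt → ∀ {m k} → k ≤ m →
                      wQP' bt m k + wPQ' bt m k + wPP bt m k ≈ s (m ∸ k)
  level-step-weight type1 _ {m} {k} _ = cancel 1# (tz t (m ∸ k)) (s (m ∸ k))
  level-step-weight type2 _ {m} {k} k≤m rewrite [k≢m]≡r₋₁[m∸k] k≤m =
    cancel′ (t (suc (m ∸ k))) (r₋₁ (m ∸ k)) (s (m ∸ k))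
  level-step-weight type3 _ {m} {k} _ =
    trans (+-congˡ (+-congʳ (+-congˡ (-‿cong (r₋₁*tz (m ∸ k)))))) (cancel′ 1# (tz t (m ∸ k)) (s (m ∸ k)))
  level-step-weight type4 _ {m} {k} k≤m with ℕ.m≤n⇒m<n∨m≡n k≤m
  ... | inj₂ ≡.refl rewrite ≡ᵇ-true k | ℕ.n∸n≡0 k =
    trans (+-cong (+-identityʳ (t 1)) (+-congˡ (-‿cong (*-identityˡ (t 1))))) (cancel₁ (t 1) (s 0))
  ... | inj₁ k<m    rewrite ≡ᵇ-false (ℕ.<⇒≢ k<m) =
    trans (+-congˡ (+-congʳ (+-congˡ (-‿cong (*-identityˡ _))))) (cancel (t (suc (m ∸ k))) 1# (s (m ∸ k)))
  level-step-weight (type5 b c) (s≈b+c , _) {m} {k} _ =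
    trans (+-identityʳ _) (trans (+-comm (c (m ∸ k)) (b (m ∸ k))) (sym (s≈b+c (m ∸ k))))

  down-step-weight : ∀ bt → Applicable s t bt → ∀ {m k} → k < m →
                     wPQ' bt m k * wQP' bt m (suc k) ≈ t (m ∸ k)
  down-step-weight type1       _            k<m rewrite ∸-suc k<m = *-identityʳ _
  down-step-weight type2       _            k<m rewrite ≡ᵇ-false (ℕ.<⇒≢ k<m) | ∸-suc k<m = *-identityˡ _
  down-step-weight type3       _            k<m rewrite ∸-suc k<m = *-identityʳ _
  down-step-weight type4       _            k<m rewrite ≡ᵇ-false (ℕ.<⇒≢ k<m) | ∸-suc k<m = *-identityˡ _
  down-step-weight (type5 b c) (_ , t≈b*c) k<m rewrite ∸-suc k<m = sym (t≈b*c _)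

module CatalanMatrix {a ℓ} (R : CommutativeRing a ℓ) (s t : ℕ → CommutativeRing.Carrier R) where
  open CommutativeRing R
  open CS R
  open Weights s t using (tprod)
  open SemiringSolver commutativeSemiring using (solve; _:=_; _:+_; _:*_)
  open import Relation.Binary.Reasoning.Setoid setoid

  c : ℕ → ℕ → Carrier
  c = catalan s t

  catalan-above-diagonal : ∀ {N k} → N < k → c N k ≈ 0#
  catalan-above-diagonal {zero}  {suc k} _ = refl
  catalan-above-diagonal {suc N} {suc k} (s<s N<k) = begin
    1# * c N k + s (suc k) * c N (suc k) + t (suc (suc k)) * c N (suc (suc k))
      ≈⟨ +-cong (+-cong (vanish N<k) (vanish (ℕ.m<n⇒m<1+n N<k))) (vanish (ℕ.m<n⇒m<1+n (ℕ.m<n⇒m<1+n N<k))) ⟩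
    0# + 0# + 0#
      ≈⟨ trans (+-identityʳ _) (+-identityʳ 0#) ⟩
    0# ∎
    where
    vanish : ∀ {x k′} → N < k′ → x * c N k′ ≈ 0#
    vanish N<k′ = trans (*-congˡ (catalan-above-diagonal N<k′)) (zeroʳ _)

  *-above-diagonal : ∀ {N k} x → N < k → x * c N k ≈ 0#
  *-above-diagonal x N<k = trans (*-congˡ (catalan-above-diagonal N<k)) (zeroʳ x)

  catalan-shift : ∀ {N k} → N ≤ k → c (suc N) (suc k) ≈ c N k
  catalan-shift {N} {k} N≤k = begin
    1# * c N k + s (suc k) * c N (suc k) + t (suc (suc k)) * c N (suc (suc k))
      ≈⟨ +-cong (+-cong (*-identityˡ _) (vanish (s≤s N≤k))) (vanish (ℕ.m<n⇒m<1+n (s≤s N≤k))) ⟩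
    c N k + 0# + 0#
      ≈⟨ trans (+-identityʳ _) (+-identityʳ _) ⟩
    c N k ∎
    where
    vanish : ∀ {x k′} → N < k′ → x * c N k′ ≈ 0#
    vanish = *-above-diagonal _

  ĉ : ℕ → ℕ → Carrier
  ĉ N a = tprod a * c N a

  ĉ-suc : ∀ N a → ĉ (suc N) (suc a) ≈ ĉ N (suc (suc a)) + s (suc a) * ĉ N (suc a) + t (suc a) * ĉ N a
  ĉ-suc N a = trans (*-congˡ (+-congʳ (+-congʳ (*-identityˡ _))))
    (solve 7 (λ A T₁ T₂ S₁ C₀ C₁ C₂ →
               (A :* T₁) :* (C₀ :+ S₁ :* C₁ :+ T₂ :* C₂)
                 := ((A :* T₁) :* T₂) :* C₂ :+ S₁ :* ((A :* T₁) :* C₁) :+ T₁ :* (A :* C₀))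
           refl (tprod a) (t (suc a)) (t (suc (suc a))) (s (suc a)) (c N a) (c N (suc a)) (c N (suc (suc a))))

  ĉ-suc-zero : ∀ N → ĉ (suc N) 0 ≈ ĉ N 1 + s 0 * ĉ N 0
  ĉ-suc-zero N =
    solve 5 (λ O S₀ T₁ C₀ C₁ → O :* (S₀ :* C₀ :+ T₁ :* C₁) := (O :* T₁) :* C₁ :+ S₀ :* (O :* C₀))
          refl 1# (s 0) (t 1) (c N 0) (c N 1)

superscript subscript : VT → ℕ
superscript (orig (P m _)) = m
superscript (orig (Q m _)) = m
superscript (bar  (P m _)) = m
superscript (bar  (Q m _)) = m
subscript (orig (P _ k)) = k
subscript (orig (Q _ k)) = k
subscript (bar  (P _ k)) = k
subscript (bar  (Q _ k)) = k

TailIn HeadIn : ℕ → VT → Set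
TailIn m (orig (P m′ _)) = m′ ≡ m
TailIn m (orig (Q m′ _)) = m′ ≡ m
TailIn m (bar _)         = ⊥
HeadIn m (orig (P m′ _)) = m′ ≡ suc m
HeadIn m (orig (Q m′ _)) = m′ ≡ m
HeadIn m (bar _)         = ⊥

TailIn-unique : ∀ {m m′} x → TailIn m x → TailIn m′ x → m ≡ m′
TailIn-unique (orig (P _ _)) ≡.refl ≡.refl = ≡.refl
TailIn-unique (orig (Q _ _)) ≡.refl ≡.refl = ≡.refl

HeadIn-unique : ∀ {m m′} x → HeadIn m x → HeadIn m′ x → m ≡ m′
HeadIn-unique (orig (P _ _)) ≡.refl ≡.refl = ≡.refl
HeadIn-unique (orig (Q _ _)) ≡.refl ≡.refl = ≡.refl

module TildeDigraph {a ℓ} (R : CommutativeRing a ℓ) (s t : ℕ → CommutativeRing.Carrier R)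
                    (n : ℕ) (ty : ℕ → CS.BlockType R) where
  open CommutativeRing R
  open CS R
  open Weights s t
  open FiniteSums R
  open WalkSums R

  barV-orig : ∀ {x w} → barV x ≡ bar w → x ≡ orig w
  barV-orig {orig _} ≡.refl = ≡.refl

  HeadIn-barV : ∀ {m} x {w} → HeadIn m x → barV x ≢ orig w
  HeadIn-barV (orig _) _ ()

  aPQ aQP aPQ' aQP' aPP aConn : ℕ → ℕ → Arc
  aPQ   m k = arc (orig (P m k)) (orig (Q m k))             (wPQ  (ty m) m k)
  aQP   m k = arc (orig (Q m k)) (orig (P (suc m) k))       (wQP  (ty m) m k)
  aPQ'  m k = arc (orig (P m k)) (orig (Q m (suc k)))       (wPQ' (ty m) m k)
  aQP'  m k = arc (orig (Q m k)) (orig (P (suc m) (suc k))) (wQP' (ty m) m k)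
  aPP   m k = arc (orig (P m k)) (orig (P (suc m) (suc k))) (wPP  (ty m) m k)
  aConn m i = arc (orig (P m i)) (orig (P (suc m) i))       1#

  rev : Arc → Arc
  rev e = arc (barV (tgt e)) (barV (src e)) (wt e)

  cross : ℕ → Arc
  cross i = arc (orig (P n i)) (bar (P n i)) (tprod (n ∸ i))

  layer : ℕ → List Arc
  layer m = blockArcs (ty m) m ++ connArcs n m

  D̃ : List Arc
  D̃ = tildeArcs n ty

  layer-All : ∀ {p} {Pr : Arc → Set p} m →
              (∀ k → k ≤ suc m → Pr (aPQ m k) × Pr (aQP m k)) →
              (∀ k → k ≤ m → Pr (aPQ' m k) × Pr (aQP' m k) × Pr (aPP m k)) →
              (∀ i → suc m < i → i ≤ n → Pr (aConn m i)) →
              All Pr (layer m)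
  layer-All {Pr = Pr} m pq-qp pq'-qp'-pp conn =
    ++⁺ (++⁺ (concat⁺ (map⁺ (applyUpTo⁺₁ id (suc (suc m)) (λ k<m+2 → pair (pq-qp _ (ℕ.≤-pred k<m+2))))))
             (concat⁺ (map⁺ (applyUpTo⁺₁ id (suc m) (λ k<m+1 → triple (pq'-qp'-pp _ (ℕ.≤-pred k<m+1)))))))
        (map⁺ (applyUpTo⁺₁ _ (n ∸ suc m)
                (λ {x} x<n∸m+1 → conn _ (s≤s (s≤s (ℕ.m≤m+n m x))) (x<N∸a⇒a+x<N (suc m) x<n∸m+1))))
    where
    pair : ∀ {e e′} → Pr e × Pr e′ → All Pr (e ∷ e′ ∷ [])
    pair (pe , pe′) = pe ∷ pe′ ∷ []
    triple : ∀ {e e′ e″} → Pr e × Pr e′ × Pr e″ → All Pr (e ∷ e′ ∷ e″ ∷ [])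
    triple (pe , pe′ , pe″) = pe ∷ pe′ ∷ pe″ ∷ []

  layer-tails : ∀ m → All (TailIn m ∘ src) (layer m)
  layer-tails m = layer-All m (λ _ _ → ≡.refl , ≡.refl) (λ _ _ → ≡.refl , ≡.refl , ≡.refl) (λ _ _ _ → ≡.refl)

  layer-heads : ∀ m → All (HeadIn m ∘ tgt) (layer m)
  layer-heads m = layer-All m (λ _ _ → ≡.refl , ≡.refl) (λ _ _ → ≡.refl , ≡.refl , ≡.refl) (λ _ _ _ → ≡.refl)

  VertexC : V → Set
  VertexC (P m k) = m ≤ n × k ≤ n
  VertexC (Q m k) = m < n × k ≤ suc m

  Vertex : VT → Set
  Vertex (orig v) = VertexC v
  Vertex (bar  v) = VertexC v

  rank : VT → ℕ
  rank (orig (P m _)) = suc (double n) +ℕ double (n ∸ m)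
  rank (orig (Q m _)) = suc (double n) +ℕ suc (double (n ∸ suc m))
  rank (bar  (P m _)) = double m
  rank (bar  (Q m _)) = suc (double m)

  Descends : Arc → Set
  Descends e = Vertex (tgt e) × rank (tgt e) < rank (src e)

  descends : All Descends D̃
  descends = ++⁺ (DC-All forward) (++⁺ (map⁺ (DC-All backward)) (map⁺ (applyUpTo⁺₁ id (suc n) crossing)))
    where
    DC-All : ∀ {Pr : Arc → Set} → (∀ {m} → m < n → All Pr (layer m)) → All Pr (DCArcs n ty)
    DC-All layers = concat⁺ (map⁺ (applyUpTo⁺₁ id n layers))

    D = suc (double n)

    P<Q : ∀ {m} → m < n → rank (orig (Q m 0)) < rank (orig (P m 0))
    P<Q {m} m<n rewrite ∸-suc m<n = ℕ.+-monoʳ-< D (ℕ.n<1+n _)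
    Q<P : ∀ m → rank (orig (P (suc m) 0)) < rank (orig (Q m 0))
    Q<P m = ℕ.+-monoʳ-< D (ℕ.n<1+n _)
    P<P : ∀ {m} → m < n → rank (orig (P (suc m) 0)) < rank (orig (P m 0))
    P<P {m} m<n rewrite ∸-suc m<n = ℕ.+-monoʳ-< D (ℕ.m<n⇒m<1+n (ℕ.n<1+n _))

    forward : ∀ {m} → m < n → All Descends (layer m)
    forward {m} m<n = layer-All m
      (λ k k≤m+1 → ((m<n , k≤m+1) , P<Q m<n) , ((m<n , ℕ.≤-trans k≤m+1 m<n) , Q<P m))
      (λ k k≤m → ((m<n , s≤s k≤m) , P<Q m<n) , ((m<n , ℕ.≤-trans (s≤s k≤m) m<n) , Q<P m)
                 , ((m<n , ℕ.≤-trans (s≤s k≤m) m<n) , P<P m<n))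
      (λ i _ i≤n → (m<n , i≤n) , P<P m<n)

    backward : ∀ {m} → m < n → All (Descends ∘ rev) (layer m)
    backward {m} m<n = layer-All m
      (λ k k≤m+1 → ((ℕ.<⇒≤ m<n , ℕ.≤-trans k≤m+1 m<n) , ℕ.n<1+n _) , ((m<n , k≤m+1) , ℕ.n<1+n _))
      (λ k k≤m → ((ℕ.<⇒≤ m<n , ℕ.≤-trans k≤m (ℕ.<⇒≤ m<n)) , ℕ.n<1+n _)
                 , ((m<n , ℕ.m≤n⇒m≤1+n k≤m) , ℕ.n<1+n _)
                 , ((ℕ.<⇒≤ m<n , ℕ.≤-trans k≤m (ℕ.<⇒≤ m<n)) , ℕ.m<n⇒m<1+n (ℕ.n<1+n _)))
      (λ i _ i≤n → (ℕ.<⇒≤ m<n , i≤n) , ℕ.m<n⇒m<1+n (ℕ.n<1+n _))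

    crossing : ∀ {i} → i < suc n → Descends (cross i)
    crossing (s≤s i≤n) = (ℕ.≤-refl , i≤n) , s≤s (ℕ.m≤m+n (double n) _)

  private
    double≤length : ∀ N (f : ℕ → ℕ) (F : ℕ → List Arc) → (∀ k → 2 ≤ length (F k)) →
                    double N ≤ length (concatMap F (applyUpTo f N))
    double≤length zero    f F long = z≤n
    double≤length (suc N) f F long = ℕ.≤-trans (ℕ.+-mono-≤ (long (f 0)) (double≤length N (f ∘ suc) F long))
                                               (ℕ.≤-reflexive (≡.sym (List.length-++ (F (f 0)))))

  rank≤length : ∀ i → rank (orig (P 0 i)) ≤ length D̃
  rank≤length i = begin
    suc (double n) +ℕ double n          ≡⟨ ℕ.+-comm (suc (double n)) (double n) ⟩
    double n +ℕ suc (double n)           ≤⟨ ℕ.+-monoʳ-≤ (double n) (s≤s (ℕ.m≤m+n (double n) n)) ⟩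
    double n +ℕ suc (double n +ℕ n)      ≡⟨ cong (double n +ℕ_) (≡.sym (ℕ.+-suc (double n) n)) ⟩
    double n +ℕ (double n +ℕ suc n)      ≤⟨ ℕ.+-mono-≤ double≤DC (ℕ.+-monoˡ-≤ (suc n) double≤DC) ⟩
    length DC +ℕ (length DC +ℕ suc n)    ≡⟨ ≡.sym length-tilde ⟩
    length D̃               ∎
    where
    open ℕ.≤-Reasoning
    DC = DCArcs n ty
    double≤DC : double n ≤ length DC
    double≤DC = double≤length n id layer (λ _ → s≤s (s≤s z≤n))
    length-tilde : length D̃ ≡ length DC +ℕ (length DC +ℕ suc n)
    length-tilde = ≡.trans (List.length-++ DC) (cong (length DC +ℕ_) (≡.trans (List.length-++ (map rev DC))
                     (≡.cong₂ _+ℕ_ (List.length-map rev DC)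
                                   (≡.trans (List.length-map cross (upTo (suc n))) (List.length-upTo (suc n))))))

  open SemiringSolver commutativeSemiring using (solve; _:=_; _:+_; con)
  open import Relation.Binary.Reasoning.Setoid setoid

  ∑-DC : ∀ f → ∑∈ (DCArcs n ty) f ≈ ∑< n (λ m → ∑∈ (layer m) f)
  ∑-DC f = trans (∑∈-concatMap (upTo n) layer f) (reflexive (∑∈-applyUpTo n id _))

  ∑-tilde : ∀ f → ∑∈ D̃ f ≈
            ∑< n (λ m → ∑∈ (layer m) f) + (∑< n (λ m → ∑∈ (layer m) (f ∘ rev)) + ∑< (suc n) (f ∘ cross))
  ∑-tilde f = trans (∑∈-++ (DCArcs n ty) _ f) (+-cong (∑-DC f) (trans (∑∈-++ (map rev (DCArcs n ty)) _ f)
                (+-cong (trans (reflexive (∑∈-map rev (DCArcs n ty) f)) (∑-DC (f ∘ rev)))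
                        (reflexive (≡.trans (∑∈-map cross (upTo (suc n)) f) (∑∈-applyUpTo (suc n) id _))))))

  private
    ∑-block₁ : ∀ m f → ∑∈ (concatMap (λ k → aPQ m k ∷ aQP m k ∷ []) (upTo (suc (suc m)))) f
                       ≈ ∑< (suc (suc m)) (f ∘ aPQ m) + ∑< (suc (suc m)) (f ∘ aQP m)
    ∑-block₁ m f = begin
      ∑∈ (concatMap (λ k → aPQ m k ∷ aQP m k ∷ []) (upTo (suc (suc m)))) f
        ≈⟨ ∑∈-concatMap (upTo (suc (suc m))) (λ k → aPQ m k ∷ aQP m k ∷ []) f ⟩
      ∑∈ (upTo (suc (suc m))) (λ k → f (aPQ m k) + (f (aQP m k) + 0#))
        ≡⟨ ∑∈-applyUpTo (suc (suc m)) id (λ k → f (aPQ m k) + (f (aQP m k) + 0#)) ⟩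
      ∑< (suc (suc m)) (λ k → f (aPQ m k) + (f (aQP m k) + 0#))
        ≈⟨ ∑<-cong (suc (suc m)) (λ k _ → +-congˡ (+-identityʳ (f (aQP m k)))) ⟩
      ∑< (suc (suc m)) (λ k → f (aPQ m k) + f (aQP m k))
        ≈⟨ ∑<-+ (suc (suc m)) (f ∘ aPQ m) (f ∘ aQP m) ⟩
      ∑< (suc (suc m)) (f ∘ aPQ m) + ∑< (suc (suc m)) (f ∘ aQP m) ∎

    ∑-block₂ : ∀ m f → ∑∈ (concatMap (λ k → aPQ' m k ∷ aQP' m k ∷ aPP m k ∷ []) (upTo (suc m))) f
                       ≈ ∑< (suc m) (f ∘ aPQ' m) + (∑< (suc m) (f ∘ aQP' m) + ∑< (suc m) (f ∘ aPP m))
    ∑-block₂ m f = begin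
      ∑∈ (concatMap (λ k → aPQ' m k ∷ aQP' m k ∷ aPP m k ∷ []) (upTo (suc m))) f
        ≈⟨ ∑∈-concatMap (upTo (suc m)) (λ k → aPQ' m k ∷ aQP' m k ∷ aPP m k ∷ []) f ⟩
      ∑∈ (upTo (suc m)) (λ k → f (aPQ' m k) + (f (aQP' m k) + (f (aPP m k) + 0#)))
        ≡⟨ ∑∈-applyUpTo (suc m) id (λ k → f (aPQ' m k) + (f (aQP' m k) + (f (aPP m k) + 0#))) ⟩
      ∑< (suc m) (λ k → f (aPQ' m k) + (f (aQP' m k) + (f (aPP m k) + 0#)))
        ≈⟨ ∑<-cong (suc m) (λ k _ → +-congˡ (+-congˡ (+-identityʳ (f (aPP m k))))) ⟩
      ∑< (suc m) (λ k → f (aPQ' m k) + (f (aQP' m k) + f (aPP m k)))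
        ≈⟨ ∑<-+ (suc m) (f ∘ aPQ' m) (λ k → f (aQP' m k) + f (aPP m k)) ⟩
      ∑< (suc m) (f ∘ aPQ' m) + ∑< (suc m) (λ k → f (aQP' m k) + f (aPP m k))
        ≈⟨ +-congˡ (∑<-+ (suc m) (f ∘ aQP' m) (f ∘ aPP m)) ⟩
      ∑< (suc m) (f ∘ aPQ' m) + (∑< (suc m) (f ∘ aQP' m) + ∑< (suc m) (f ∘ aPP m)) ∎

    ∑-conn : ∀ m f → ∑∈ (connArcs n m) f ≡ ∑< (n ∸ suc m) (λ x → f (aConn m (suc (suc m) +ℕ x)))
    ∑-conn m f = ≡.trans (∑∈-map (aConn m) (range (suc (suc m)) (suc n)) f)
                         (∑∈-applyUpTo (n ∸ suc m) (suc (suc m) +ℕ_) (f ∘ aConn m))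

  ∑-layer : ∀ m f {A B C D E F} →
            ∑< (suc (suc m)) (f ∘ aPQ m) ≈ A → ∑< (suc (suc m)) (f ∘ aQP m) ≈ B →
            ∑< (suc m) (f ∘ aPQ' m) ≈ C → ∑< (suc m) (f ∘ aQP' m) ≈ D → ∑< (suc m) (f ∘ aPP m) ≈ E →
            ∑< (n ∸ suc m) (λ x → f (aConn m (suc (suc m) +ℕ x))) ≈ F →
            ∑∈ (layer m) f ≈ (A + B) + (C + (D + E)) + F
  ∑-layer m f ≈A ≈B ≈C ≈D ≈E ≈F =
    trans (∑∈-++ (blockArcs (ty m) m) (connArcs n m) f)
      (+-cong (trans (∑∈-++ (concatMap (λ k → aPQ m k ∷ aQP m k ∷ []) (upTo (suc (suc m)))) _ f)
                     (+-cong (trans (∑-block₁ m f) (+-cong ≈A ≈B))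
                             (trans (∑-block₂ m f) (+-cong ≈C (+-cong ≈D ≈E)))))
              (trans (reflexive (∑-conn m f)) ≈F))

  module OutSums (G : VT → Carrier) where

    private
      hit : ∀ N (F : ℕ → Arc) u k₀ → k₀ < N → src (F k₀) ≡ u → (∀ k → src (F k) ≡ u → k ≡ k₀) →
            ∑< N (outTerm G u ∘ F) ≈ wt (F k₀) * G (tgt (F k₀))
      hit N F u k₀ k₀<N here unique =
        trans (∑<-single N k₀ k₀<N (λ k _ k≢k₀ → outTerm-miss G (F k) (k≢k₀ ∘ unique k)))
              (outTerm-hit G (F k₀) here)

      miss : ∀ N (F : ℕ → Arc) u → (∀ k → k < N → src (F k) ≢ u) → ∑< N (outTerm G u ∘ F) ≈ 0#
      miss N F u away = ∑<-vanish N (λ k k<N → outTerm-miss G (F k) (away k k<N))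

      beyond : ∀ N (F : ℕ → Arc) u → (∀ i → i < N → subscript (src (F i)) < subscript u) →
               ∑< N (outTerm G u ∘ F) ≈ 0#
      beyond N F u lower = miss N F u (λ i i<N eq → ℕ.<-irrefl (cong subscript eq) (lower i i<N))

      elsewhere : ∀ {k} (F : ℕ → Arc) u → (∀ {i} → src (F i) ≡ u → i ≡ k) →
                  ∀ i → i ≢ k → outTerm G u (F i) ≈ 0#
      elsewhere F u at i i≢k = outTerm-miss G (F i) (i≢k ∘ at)

      conn-hit : ∀ {m k} (f : Arc → Carrier) → suc m < k → k ≤ n → (∀ i → i ≢ k → f (aConn m i) ≈ 0#) →
                 ∑< (n ∸ suc m) (λ x → f (aConn m (suc (suc m) +ℕ x))) ≈ f (aConn m k)
      conn-hit {m} {k} f m+1<k k≤n others = begin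
        ∑< (n ∸ suc m) (λ x → f (aConn m (suc (suc m) +ℕ x)))
          ≈⟨ ∑<-single (n ∸ suc m) (k ∸ suc (suc m)) (ℕ.∸-monoˡ-< (s≤s k≤n) m+1<k)
               (λ x _ x≢ → others _ (λ eq → x≢ (≡.trans (≡.sym (ℕ.m+n∸m≡n (suc (suc m)) x))
                                                         (cong (_∸ suc (suc m)) eq)))) ⟩
        f (aConn m (suc (suc m) +ℕ (k ∸ suc (suc m))))
          ≡⟨ cong (f ∘ aConn m) (ℕ.m+[n∸m]≡n m+1<k) ⟩
        f (aConn m k) ∎

      conn-miss : ∀ {m k} (f : Arc → Carrier) → k ≤ suc m → (∀ i → i ≢ k → f (aConn m i) ≈ 0#) →
                  ∑< (n ∸ suc m) (λ x → f (aConn m (suc (suc m) +ℕ x))) ≈ 0#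
      conn-miss {m} f k≤m+1 others =
        ∑<-vanish (n ∸ suc m)
          (λ x _ → others _ (λ eq → ℕ.<⇒≢ (s≤s (ℕ.≤-trans k≤m+1 (s≤s (ℕ.m≤m+n m x)))) (≡.sym eq)))

      outSum-orig : ∀ {m} w → m < n → TailIn m (orig w) → (∀ i → orig (P n i) ≢ orig w) →
                    outSum D̃ G (orig w) ≈ ∑∈ (layer m) (outTerm G (orig w))
      outSum-orig {m} w m<n tail notTop = begin
        outSum D̃ G (orig w)
          ≈⟨ ∑-tilde (outTerm G (orig w)) ⟩
        ∑< n (λ m′ → ∑∈ (layer m′) (outTerm G (orig w)))
          + (∑< n (λ m′ → ∑∈ (layer m′) (outTerm G (orig w) ∘ rev)) + ∑< (suc n) (outTerm G (orig w) ∘ cross))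
          ≈⟨ +-cong (∑<-single n m m<n
                      (λ m′ _ m′≢m → ∑∈-vanish (All.map (otherLayer m′≢m) (layer-tails m′))))
                    (+-cong (∑<-vanish n (λ m′ _ → ∑∈-vanish (All.map reversed (layer-heads m′))))
                            (∑<-vanish (suc n) (λ i _ → outTerm-miss G (cross i) (notTop i)))) ⟩
        ∑∈ (layer m) (outTerm G (orig w)) + (0# + 0#)
          ≈⟨ trans (+-congˡ (+-identityʳ 0#)) (+-identityʳ _) ⟩
        ∑∈ (layer m) (outTerm G (orig w)) ∎
        where
        otherLayer : ∀ {m′ e} → m′ ≢ m → TailIn m′ (src e) → outTerm G (orig w) e ≈ 0#
        otherLayer {e = e} m′≢m tail′ =
          outTerm-miss G e (λ eq → m′≢m (TailIn-unique (orig w) (≡.subst (TailIn _) eq tail′) tail))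
        reversed : ∀ {m′ e} → HeadIn m′ (tgt e) → outTerm G (orig w) (rev e) ≈ 0#
        reversed {e = e} head = outTerm-miss G (rev e) (HeadIn-barV (tgt e) head)

      outSum-bar : ∀ {m} w → m < n → HeadIn m (orig w) →
                   outSum D̃ G (bar w) ≈ ∑∈ (layer m) (outTerm G (bar w) ∘ rev)
      outSum-bar {m} w m<n head = begin
        outSum D̃ G (bar w)
          ≈⟨ ∑-tilde (outTerm G (bar w)) ⟩
        ∑< n (λ m′ → ∑∈ (layer m′) (outTerm G (bar w)))
          + (∑< n (λ m′ → ∑∈ (layer m′) (outTerm G (bar w) ∘ rev)) + ∑< (suc n) (outTerm G (bar w) ∘ cross))
          ≈⟨ +-cong (∑<-vanish n (λ m′ _ → ∑∈-vanish (All.map forward (layer-tails m′))))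
                    (+-cong (∑<-single n m m<n
                               (λ m′ _ m′≢m → ∑∈-vanish (All.map (otherLayer m′≢m) (layer-heads m′))))
                            (∑<-vanish (suc n) (λ i _ → outTerm-miss G {bar w} (cross i) (λ ())))) ⟩
        0# + (∑∈ (layer m) (outTerm G (bar w) ∘ rev) + 0#)
          ≈⟨ trans (+-identityˡ _) (+-identityʳ _) ⟩
        ∑∈ (layer m) (outTerm G (bar w) ∘ rev) ∎
        where
        forward : ∀ {m′ e} → TailIn m′ (src e) → outTerm G (bar w) e ≈ 0#
        forward {m′} {e} tail = outTerm-miss G e (λ eq → ≡.subst (TailIn m′) eq tail)
        otherLayer : ∀ {m′ e} → m′ ≢ m → HeadIn m′ (tgt e) → outTerm G (bar w) (rev e) ≈ 0#
        otherLayer {e = e} m′≢m head′ =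
          outTerm-miss G (rev e) (λ eq → m′≢m (HeadIn-unique (orig w) (≡.subst (HeadIn _) (barV-orig eq) head′) head))

    out-P-top : ∀ {k} → k ≤ n → outSum D̃ G (orig (P n k)) ≈ tprod (n ∸ k) * G (bar (P n k))
    out-P-top {k} k≤n = begin
      outSum D̃ G u
        ≈⟨ ∑-tilde (outTerm G u) ⟩
      ∑< n (λ m → ∑∈ (layer m) (outTerm G u))
        + (∑< n (λ m → ∑∈ (layer m) (outTerm G u ∘ rev)) + ∑< (suc n) (outTerm G u ∘ cross))
        ≈⟨ +-cong (∑<-vanish n (λ m m<n → ∑∈-vanish (All.map (forward m<n) (layer-tails m))))
                  (+-cong (∑<-vanish n (λ m _ → ∑∈-vanish (All.map reversed (layer-heads m))))
                          (hit (suc n) cross u k (s≤s k≤n) ≡.refl (λ _ → cong subscript))) ⟩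
      0# + (0# + tprod (n ∸ k) * G (bar (P n k)))
        ≈⟨ trans (+-identityˡ _) (+-identityˡ _) ⟩
      tprod (n ∸ k) * G (bar (P n k)) ∎
      where
      u = orig (P n k)
      forward : ∀ {m e} → m < n → TailIn m (src e) → outTerm G u e ≈ 0#
      forward {m} {e} m<n tail = outTerm-miss G e (λ eq → ℕ.<-irrefl (≡.sym (≡.subst (TailIn m) eq tail)) m<n)
      reversed : ∀ {m e} → HeadIn m (tgt e) → outTerm G u (rev e) ≈ 0#
      reversed {e = e} head = outTerm-miss G (rev e) (HeadIn-barV (tgt e) head)

    out-P̄-bottom : ∀ {k} → outSum D̃ G (bar (P 0 k)) ≈ 0#
    out-P̄-bottom {k} = begin
      outSum D̃ G u
        ≈⟨ ∑-tilde (outTerm G u) ⟩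
      ∑< n (λ m → ∑∈ (layer m) (outTerm G u))
        + (∑< n (λ m → ∑∈ (layer m) (outTerm G u ∘ rev)) + ∑< (suc n) (outTerm G u ∘ cross))
        ≈⟨ +-cong (∑<-vanish n (λ m _ → ∑∈-vanish (All.map forward (layer-tails m))))
                  (+-cong (∑<-vanish n (λ m _ → ∑∈-vanish (All.map reversed (layer-heads m))))
                          (∑<-vanish (suc n) (λ i _ → outTerm-miss G {u} (cross i) (λ ())))) ⟩
      0# + (0# + 0#)
        ≈⟨ trans (+-identityˡ _) (+-identityˡ _) ⟩
      0# ∎
      where
      u = bar (P 0 k)
      forward : ∀ {m e} → TailIn m (src e) → outTerm G u e ≈ 0#
      forward {m} {e} tail = outTerm-miss G e (λ eq → ≡.subst (TailIn m) eq tail)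
      reversed : ∀ {m e} → HeadIn m (tgt e) → outTerm G u (rev e) ≈ 0#
      reversed {m} {e} head = outTerm-miss G (rev e) (λ eq → ℕ.0≢1+n (≡.subst (HeadIn m) (barV-orig eq) head))

    private
      notTop : ∀ {m k} → m < n → ∀ i → orig (P n i) ≢ orig (P m k)
      notTop m<n i eq = ℕ.<⇒≢ m<n (≡.sym (cong superscript eq))

    out-P : ∀ {m k} → m < n → k ≤ m → outSum D̃ G (orig (P m k)) ≈
            wPQ (ty m) m k * G (orig (Q m k))
              + (wPQ' (ty m) m k * G (orig (Q m (suc k))) + wPP (ty m) m k * G (orig (P (suc m) (suc k))))
    out-P {m} {k} m<n k≤m = begin
      outSum D̃ G u
        ≈⟨ outSum-orig (P m k) m<n ≡.refl (notTop m<n) ⟩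
      ∑∈ (layer m) (outTerm G u)
        ≈⟨ ∑-layer m (outTerm G u)
             (hit (suc (suc m)) (aPQ m) u k (s≤s (ℕ.m≤n⇒m≤1+n k≤m)) ≡.refl (λ _ → cong subscript))
             (miss (suc (suc m)) (aQP m) u (λ _ _ ()))
             (hit (suc m) (aPQ' m) u k (s≤s k≤m) ≡.refl (λ _ → cong subscript))
             (miss (suc m) (aQP' m) u (λ _ _ ()))
             (hit (suc m) (aPP m) u k (s≤s k≤m) ≡.refl (λ _ → cong subscript))
             (conn-miss (outTerm G u) (ℕ.m≤n⇒m≤1+n k≤m) (elsewhere (aConn m) u (cong subscript))) ⟩
      (x + 0#) + (y + (0# + z)) + 0#
        ≈⟨ solve 3 (λ x y z → (x :+ con 0) :+ (y :+ (con 0 :+ z)) :+ con 0 := x :+ (y :+ z)) refl x y z ⟩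
      x + (y + z) ∎
      where
      u = orig (P m k)
      x = wPQ (ty m) m k * G (orig (Q m k))
      y = wPQ' (ty m) m k * G (orig (Q m (suc k)))
      z = wPP (ty m) m k * G (orig (P (suc m) (suc k)))

    out-P-edge : ∀ {m} → m < n → outSum D̃ G (orig (P m (suc m))) ≈ wPQ (ty m) m (suc m) * G (orig (Q m (suc m)))
    out-P-edge {m} m<n = begin
      outSum D̃ G u
        ≈⟨ outSum-orig (P m (suc m)) m<n ≡.refl (notTop m<n) ⟩
      ∑∈ (layer m) (outTerm G u)
        ≈⟨ ∑-layer m (outTerm G u)
             (hit (suc (suc m)) (aPQ m) u (suc m) (ℕ.n<1+n (suc m)) ≡.refl (λ _ → cong subscript))
             (miss (suc (suc m)) (aQP m) u (λ _ _ ()))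
             (beyond (suc m) (aPQ' m) u (λ _ → id))
             (miss (suc m) (aQP' m) u (λ _ _ ()))
             (beyond (suc m) (aPP m) u (λ _ → id))
             (conn-miss (outTerm G u) ℕ.≤-refl (elsewhere (aConn m) u (cong subscript))) ⟩
      (x + 0#) + (0# + (0# + 0#)) + 0#
        ≈⟨ solve 1 (λ x → (x :+ con 0) :+ (con 0 :+ (con 0 :+ con 0)) :+ con 0 := x) refl x ⟩
      x ∎
      where
      u = orig (P m (suc m))
      x = wPQ (ty m) m (suc m) * G (orig (Q m (suc m)))

    out-P-conn : ∀ {m k} → m < n → suc m < k → k ≤ n → outSum D̃ G (orig (P m k)) ≈ G (orig (P (suc m) k))
    out-P-conn {m} {k} m<n m+1<k k≤n = begin
      outSum D̃ G u
        ≈⟨ outSum-orig (P m k) m<n ≡.refl (notTop m<n) ⟩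
      ∑∈ (layer m) (outTerm G u)
        ≈⟨ ∑-layer m (outTerm G u)
             (beyond (suc (suc m)) (aPQ m) u (λ _ i<m+2 → ℕ.<-≤-trans i<m+2 m+1<k))
             (miss (suc (suc m)) (aQP m) u (λ _ _ ()))
             (beyond (suc m) (aPQ' m) u (λ _ i<m+1 → ℕ.<-trans i<m+1 m+1<k))
             (miss (suc m) (aQP' m) u (λ _ _ ()))
             (beyond (suc m) (aPP m) u (λ _ i<m+1 → ℕ.<-trans i<m+1 m+1<k))
             (conn-hit (outTerm G u) m+1<k k≤n (elsewhere (aConn m) u (cong subscript))) ⟩
      (0# + 0#) + (0# + (0# + 0#)) + outTerm G u (aConn m k)
        ≈⟨ solve 1 (λ x → (con 0 :+ con 0) :+ (con 0 :+ (con 0 :+ con 0)) :+ x := x) refl _ ⟩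
      outTerm G u (aConn m k)
        ≈⟨ trans (outTerm-hit G (aConn m k) ≡.refl) (*-identityˡ _) ⟩
      G (orig (P (suc m) k)) ∎
      where
      u = orig (P m k)

    out-Q : ∀ {m k} → m < n → k ≤ m → outSum D̃ G (orig (Q m k)) ≈
            wQP (ty m) m k * G (orig (P (suc m) k)) + wQP' (ty m) m k * G (orig (P (suc m) (suc k)))
    out-Q {m} {k} m<n k≤m = begin
      outSum D̃ G u
        ≈⟨ outSum-orig (Q m k) m<n ≡.refl (λ _ ()) ⟩
      ∑∈ (layer m) (outTerm G u)
        ≈⟨ ∑-layer m (outTerm G u)
             (miss (suc (suc m)) (aPQ m) u (λ _ _ ()))
             (hit (suc (suc m)) (aQP m) u k (s≤s (ℕ.m≤n⇒m≤1+n k≤m)) ≡.refl (λ _ → cong subscript))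
             (miss (suc m) (aPQ' m) u (λ _ _ ()))
             (hit (suc m) (aQP' m) u k (s≤s k≤m) ≡.refl (λ _ → cong subscript))
             (miss (suc m) (aPP m) u (λ _ _ ()))
             (conn-miss (outTerm G u) (ℕ.m≤n⇒m≤1+n k≤m) (elsewhere (aConn m) u (λ ()))) ⟩
      (0# + x) + (0# + (y + 0#)) + 0#
        ≈⟨ solve 2 (λ x y → (con 0 :+ x) :+ (con 0 :+ (y :+ con 0)) :+ con 0 := x :+ y) refl x y ⟩
      x + y ∎
      where
      u = orig (Q m k)
      x = wQP (ty m) m k * G (orig (P (suc m) k))
      y = wQP' (ty m) m k * G (orig (P (suc m) (suc k)))

    out-Q-edge : ∀ {m} → m < n → outSum D̃ G (orig (Q m (suc m))) ≈ wQP (ty m) m (suc m) * G (orig (P (suc m) (suc m)))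
    out-Q-edge {m} m<n = begin
      outSum D̃ G u
        ≈⟨ outSum-orig (Q m (suc m)) m<n ≡.refl (λ _ ()) ⟩
      ∑∈ (layer m) (outTerm G u)
        ≈⟨ ∑-layer m (outTerm G u)
             (miss (suc (suc m)) (aPQ m) u (λ _ _ ()))
             (hit (suc (suc m)) (aQP m) u (suc m) (ℕ.n<1+n (suc m)) ≡.refl (λ _ → cong subscript))
             (miss (suc m) (aPQ' m) u (λ _ _ ()))
             (beyond (suc m) (aQP' m) u (λ _ → id))
             (miss (suc m) (aPP m) u (λ _ _ ()))
             (conn-miss (outTerm G u) ℕ.≤-refl (elsewhere (aConn m) u (λ ()))) ⟩
      (0# + x) + (0# + (0# + 0#)) + 0#
        ≈⟨ solve 1 (λ x → (con 0 :+ x) :+ (con 0 :+ (con 0 :+ con 0)) :+ con 0 := x) refl x ⟩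
      x ∎
      where
      u = orig (Q m (suc m))
      x = wQP (ty m) m (suc m) * G (orig (P (suc m) (suc m)))

    out-Q̄-zero : ∀ {m} → m < n → outSum D̃ G (bar (Q m 0)) ≈ wPQ (ty m) m 0 * G (bar (P m 0))
    out-Q̄-zero {m} m<n = begin
      outSum D̃ G u
        ≈⟨ outSum-bar (Q m 0) m<n ≡.refl ⟩
      ∑∈ (layer m) (outTerm G u ∘ rev)
        ≈⟨ ∑-layer m (outTerm G u ∘ rev)
             (hit (suc (suc m)) (rev ∘ aPQ m) u 0 z<s ≡.refl (λ _ → cong subscript))
             (miss (suc (suc m)) (rev ∘ aQP m) u (λ _ _ ()))
             (miss (suc m) (rev ∘ aPQ' m) u (λ _ _ ()))
             (miss (suc m) (rev ∘ aQP' m) u (λ _ _ ()))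
             (miss (suc m) (rev ∘ aPP m) u (λ _ _ ()))
             (conn-miss (outTerm G u ∘ rev) z≤n (elsewhere (rev ∘ aConn m) u (λ ()))) ⟩
      (x + 0#) + (0# + (0# + 0#)) + 0#
        ≈⟨ solve 1 (λ x → (x :+ con 0) :+ (con 0 :+ (con 0 :+ con 0)) :+ con 0 := x) refl x ⟩
      x ∎
      where
      u = bar (Q m 0)
      x = wPQ (ty m) m 0 * G (bar (P m 0))

    out-Q̄-suc : ∀ {m k} → m < n → k ≤ m → outSum D̃ G (bar (Q m (suc k))) ≈
                wPQ (ty m) m (suc k) * G (bar (P m (suc k))) + wPQ' (ty m) m k * G (bar (P m k))
    out-Q̄-suc {m} {k} m<n k≤m = begin
      outSum D̃ G u
        ≈⟨ outSum-bar (Q m (suc k)) m<n ≡.refl ⟩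
      ∑∈ (layer m) (outTerm G u ∘ rev)
        ≈⟨ ∑-layer m (outTerm G u ∘ rev)
             (hit (suc (suc m)) (rev ∘ aPQ m) u (suc k) (s≤s (s≤s k≤m)) ≡.refl (λ _ → cong subscript))
             (miss (suc (suc m)) (rev ∘ aQP m) u (λ _ _ ()))
             (hit (suc m) (rev ∘ aPQ' m) u k (s≤s k≤m) ≡.refl (λ _ → ℕ.suc-injective ∘ cong subscript))
             (miss (suc m) (rev ∘ aQP' m) u (λ _ _ ()))
             (miss (suc m) (rev ∘ aPP m) u (λ _ _ ()))
             (conn-miss (outTerm G u ∘ rev) z≤n (elsewhere (rev ∘ aConn m) u (λ ()))) ⟩
      (x + 0#) + (y + (0# + 0#)) + 0#
        ≈⟨ solve 2 (λ x y → (x :+ con 0) :+ (y :+ (con 0 :+ con 0)) :+ con 0 := x :+ y) refl x y ⟩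
      x + y ∎
      where
      u = bar (Q m (suc k))
      x = wPQ (ty m) m (suc k) * G (bar (P m (suc k)))
      y = wPQ' (ty m) m k * G (bar (P m k))

    out-P̄-zero : ∀ {m} → m < n → outSum D̃ G (bar (P (suc m) 0)) ≈ wQP (ty m) m 0 * G (bar (Q m 0))
    out-P̄-zero {m} m<n = begin
      outSum D̃ G u
        ≈⟨ outSum-bar (P (suc m) 0) m<n ≡.refl ⟩
      ∑∈ (layer m) (outTerm G u ∘ rev)
        ≈⟨ ∑-layer m (outTerm G u ∘ rev)
             (miss (suc (suc m)) (rev ∘ aPQ m) u (λ _ _ ()))
             (hit (suc (suc m)) (rev ∘ aQP m) u 0 z<s ≡.refl (λ _ → cong subscript))
             (miss (suc m) (rev ∘ aPQ' m) u (λ _ _ ()))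
             (miss (suc m) (rev ∘ aQP' m) u (λ _ _ ()))
             (miss (suc m) (rev ∘ aPP m) u (λ _ _ ()))
             (conn-miss (outTerm G u ∘ rev) z≤n (elsewhere (rev ∘ aConn m) u (cong subscript))) ⟩
      (0# + x) + (0# + (0# + 0#)) + 0#
        ≈⟨ solve 1 (λ x → (con 0 :+ x) :+ (con 0 :+ (con 0 :+ con 0)) :+ con 0 := x) refl x ⟩
      x ∎
      where
      u = bar (P (suc m) 0)
      x = wQP (ty m) m 0 * G (bar (Q m 0))

    out-P̄-suc : ∀ {m k} → m < n → k ≤ m → outSum D̃ G (bar (P (suc m) (suc k))) ≈
                wQP (ty m) m (suc k) * G (bar (Q m (suc k)))
                  + (wQP' (ty m) m k * G (bar (Q m k)) + wPP (ty m) m k * G (bar (P m k)))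
    out-P̄-suc {m} {k} m<n k≤m = begin
      outSum D̃ G u
        ≈⟨ outSum-bar (P (suc m) (suc k)) m<n ≡.refl ⟩
      ∑∈ (layer m) (outTerm G u ∘ rev)
        ≈⟨ ∑-layer m (outTerm G u ∘ rev)
             (miss (suc (suc m)) (rev ∘ aPQ m) u (λ _ _ ()))
             (hit (suc (suc m)) (rev ∘ aQP m) u (suc k) (s≤s (s≤s k≤m)) ≡.refl (λ _ → cong subscript))
             (miss (suc m) (rev ∘ aPQ' m) u (λ _ _ ()))
             (hit (suc m) (rev ∘ aQP' m) u k (s≤s k≤m) ≡.refl (λ _ → ℕ.suc-injective ∘ cong subscript))
             (hit (suc m) (rev ∘ aPP m) u k (s≤s k≤m) ≡.refl (λ _ → ℕ.suc-injective ∘ cong subscript))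
             (conn-miss (outTerm G u ∘ rev) (s≤s k≤m) (elsewhere (rev ∘ aConn m) u (cong subscript))) ⟩
      (0# + x) + (0# + (y + z)) + 0#
        ≈⟨ solve 3 (λ x y z → (con 0 :+ x) :+ (con 0 :+ (y :+ z)) :+ con 0 := x :+ (y :+ z)) refl x y z ⟩
      x + (y + z) ∎
      where
      u = bar (P (suc m) (suc k))
      x = wQP (ty m) m (suc k) * G (bar (Q m (suc k)))
      y = wQP' (ty m) m k * G (bar (Q m k))
      z = wPP (ty m) m k * G (bar (P m k))

    out-P̄-conn : ∀ {m k} → m < n → suc m < k → k ≤ n → outSum D̃ G (bar (P (suc m) k)) ≈ G (bar (P m k))
    out-P̄-conn {m} {k} m<n m+1<k k≤n = begin
      outSum D̃ G u
        ≈⟨ outSum-bar (P (suc m) k) m<n ≡.refl ⟩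
      ∑∈ (layer m) (outTerm G u ∘ rev)
        ≈⟨ ∑-layer m (outTerm G u ∘ rev)
             (miss (suc (suc m)) (rev ∘ aPQ m) u (λ _ _ ()))
             (beyond (suc (suc m)) (rev ∘ aQP m) u (λ _ i<m+2 → ℕ.<-≤-trans i<m+2 m+1<k))
             (miss (suc m) (rev ∘ aPQ' m) u (λ _ _ ()))
             (beyond (suc m) (rev ∘ aQP' m) u (λ _ i<m+1 → ℕ.<-≤-trans (s≤s i<m+1) m+1<k))
             (beyond (suc m) (rev ∘ aPP m) u (λ _ i<m+1 → ℕ.<-≤-trans (s≤s i<m+1) m+1<k))
             (conn-hit (outTerm G u ∘ rev) m+1<k k≤n (elsewhere (rev ∘ aConn m) u (cong subscript))) ⟩
      (0# + 0#) + (0# + (0# + 0#)) + outTerm G u (rev (aConn m k))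
        ≈⟨ solve 1 (λ x → (con 0 :+ con 0) :+ (con 0 :+ (con 0 :+ con 0)) :+ x := x) refl _ ⟩
      outTerm G u (rev (aConn m k))
        ≈⟨ trans (outTerm-hit G (rev (aConn m k)) ≡.refl) (*-identityˡ _) ⟩
      G (bar (P m k)) ∎
      where
      u = bar (P (suc m) k)

module Potentials {a ℓ} (R : CommutativeRing a ℓ) (s t : ℕ → CommutativeRing.Carrier R)
                  (n j : ℕ) (j≤n : j ≤ n) where
  open CommutativeRing R
  open CatalanMatrix R s t
  open import Relation.Binary.Reasoning.Setoid setoid

  b : ℕ
  b = n ∸ j

  -- For k > m, P_k^{(m)} can only climb the weight-1 arcs to P_k^{(k)}.
  gP : ℕ → ℕ → Carrier
  gP m k = if k ≤ᵇ m then ĉ (n ∸ m +ℕ j) (m ∸ k) else ĉ (n ∸ k +ℕ j) 0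

  -- GF_{D^{C_n}}(P_b^{(0)}, P_k^{(m)}): before level b only the connecting arcs are available.
  gP̄ : ℕ → ℕ → Carrier
  gP̄ m k = if b ≤ᵇ m then (if k ≤ᵇ m then c (m ∸ b) (m ∸ k) else 0#) else (if k ≡ᵇ b then 1# else 0#)

  gP-≤ : ∀ {m k N h} → k ≤ m → n ∸ m +ℕ j ≡ N → m ∸ k ≡ h → gP m k ≡ ĉ N h
  gP-≤ k≤m ≡.refl ≡.refl rewrite ≤ᵇ-true k≤m = ≡.refl

  gP-> : ∀ {m k} → m < k → gP m k ≡ ĉ (n ∸ k +ℕ j) 0
  gP-> m<k rewrite ≤ᵇ-false m<k = ≡.refl

  gP̄-low : ∀ {m} k → m < b → gP̄ m k ≡ (if k ≡ᵇ b then 1# else 0#)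
  gP̄-low k m<b rewrite ≤ᵇ-false m<b = ≡.refl

  gP̄-low-≢ : ∀ {m k} → m < b → k ≢ b → gP̄ m k ≡ 0#
  gP̄-low-≢ {k = k} m<b k≢b rewrite gP̄-low k m<b | ≡ᵇ-false k≢b = ≡.refl

  gP̄-high : ∀ {m k N h} → b ≤ m → k ≤ m → m ∸ b ≡ N → m ∸ k ≡ h → gP̄ m k ≡ c N h
  gP̄-high b≤m k≤m ≡.refl ≡.refl rewrite ≤ᵇ-true b≤m | ≤ᵇ-true k≤m = ≡.refl

  gP̄-high-> : ∀ {m k} → b ≤ m → m < k → gP̄ m k ≡ 0#
  gP̄-high-> b≤m m<k rewrite ≤ᵇ-true b≤m | ≤ᵇ-false m<k = ≡.refl

  gP-top : ∀ {k} → k ≤ n → gP n k ≡ ĉ j (n ∸ k)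
  gP-top k≤n = gP-≤ k≤n (cong (_+ℕ j) (ℕ.n∸n≡0 n)) ≡.refl

  gP̄-top : ∀ {k} → k ≤ n → gP̄ n k ≡ c j (n ∸ k)
  gP̄-top k≤n = gP̄-high (ℕ.m∸n≤m n j) k≤n (ℕ.m∸[m∸n]≡n j≤n) ≡.refl

  gP-start : ∀ k → gP 0 k ≡ ĉ (n ∸ k +ℕ j) 0
  gP-start zero    = ≡.refl
  gP-start (suc k) = ≡.refl

  gP-below-diagonal : ∀ {m k} → m < n → k < m →
    gP m k ≈ gP (suc m) k + s (m ∸ k) * gP (suc m) (suc k) + t (m ∸ k) * gP (suc m) (suc (suc k))
  gP-below-diagonal {m} {k} m<n k<m = begin
    gP m k
      ≡⟨ gP-≤ (ℕ.<⇒≤ k<m) (cong (_+ℕ j) (∸-suc m<n)) m∸k ⟩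
    ĉ (suc N) (suc h)
      ≈⟨ ĉ-suc N h ⟩
    ĉ N (suc (suc h)) + s (suc h) * ĉ N (suc h) + t (suc h) * ĉ N h
      ≡⟨ ≡.sym (≡.cong₂ _+_ (≡.cong₂ _+_ at-k (≡.cong₂ _*_ (cong s m∸k) at-k+1))
                            (≡.cong₂ _*_ (cong t m∸k) at-k+2)) ⟩
    gP (suc m) k + s (m ∸ k) * gP (suc m) (suc k) + t (m ∸ k) * gP (suc m) (suc (suc k)) ∎
    where
    N = n ∸ suc m +ℕ j
    h = m ∸ suc k
    m∸k : m ∸ k ≡ suc h
    m∸k = ∸-suc k<m
    at-k : gP (suc m) k ≡ ĉ N (suc (suc h))
    at-k = gP-≤ (ℕ.m≤n⇒m≤1+n (ℕ.<⇒≤ k<m)) ≡.refl (≡.trans (ℕ.+-∸-assoc 1 (ℕ.<⇒≤ k<m)) (cong suc m∸k))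
    at-k+1 : gP (suc m) (suc k) ≡ ĉ N (suc h)
    at-k+1 = gP-≤ (s≤s (ℕ.<⇒≤ k<m)) ≡.refl m∸k
    at-k+2 : gP (suc m) (suc (suc k)) ≡ ĉ N h
    at-k+2 = gP-≤ (s≤s k<m) ≡.refl ≡.refl

  gP-diagonal : ∀ {m} → m < n → gP m m ≈ gP (suc m) m + s 0 * gP (suc m) (suc m)
  gP-diagonal {m} m<n = begin
    gP m m                                  ≡⟨ gP-≤ (ℕ.≤-refl {m}) (cong (_+ℕ j) (∸-suc m<n)) (ℕ.n∸n≡0 m) ⟩
    ĉ (suc N) 0                             ≈⟨ ĉ-suc-zero N ⟩
    ĉ N 1 + s 0 * ĉ N 0                     ≡⟨ ≡.sym (≡.cong₂ _+_ at-m (cong (s 0 *_) at-m+1)) ⟩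
    gP (suc m) m + s 0 * gP (suc m) (suc m) ∎
    where
    N = n ∸ suc m +ℕ j
    at-m : gP (suc m) m ≡ ĉ N 1
    at-m = gP-≤ (ℕ.n≤1+n m) ≡.refl (ℕ.m+n∸n≡m 1 m)
    at-m+1 : gP (suc m) (suc m) ≡ ĉ N 0
    at-m+1 = gP-≤ (ℕ.≤-refl {suc m}) ≡.refl (ℕ.n∸n≡0 m)

  gP-above-diagonal : ∀ {m k} → m < k → gP m k ≡ gP (suc m) k
  gP-above-diagonal {m} {k} m<k with ℕ.m≤n⇒m<n∨m≡n m<k
  ... | inj₂ ≡.refl = ≡.trans (gP-> m<k) (≡.sym (gP-≤ (ℕ.≤-refl {suc m}) ≡.refl (ℕ.n∸n≡0 m)))
  ... | inj₁ m+1<k  = ≡.trans (gP-> m<k) (≡.sym (gP-> m+1<k))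

  gP̄-down : ℕ → ℕ → Carrier
  gP̄-down m zero    = 0#
  gP̄-down m (suc k) = t (m ∸ k) * gP̄ m k

  private
    low-terms-vanish : ∀ {m k} → m < b → k ≤ m → ∀ x → x * gP̄ m k + gP̄-down m k ≈ 0#
    low-terms-vanish {m} {k} m<b k≤m x =
      trans (+-cong (trans (*-congˡ (vanish k≤m)) (zeroʳ x)) (down k≤m)) (+-identityʳ 0#)
      where
      vanish : ∀ {k} → k ≤ m → gP̄ m k ≈ 0#
      vanish k≤m = reflexive (gP̄-low-≢ m<b (ℕ.<⇒≢ (ℕ.≤-<-trans k≤m m<b)))
      down : ∀ {k} → k ≤ m → gP̄-down m k ≈ 0#
      down {zero}  _     = refl
      down {suc k} k+1≤m = trans (*-congˡ (vanish (ℕ.≤-trans (ℕ.n≤1+n k) k+1≤m))) (zeroʳ _)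

  gP̄-start-b : gP̄ 0 b ≈ 1#
  gP̄-start-b with ℕ.m≤n⇒m<n∨m≡n (z≤n {b})
  ... | inj₁ 0<b  rewrite gP̄-low b 0<b | ≡ᵇ-true b = refl
  ... | inj₂ 0≡b  = reflexive (gP̄-high b≤0 b≤0 (ℕ.0∸n≡0 b) (ℕ.0∸n≡0 b))
    where b≤0 = ℕ.≤-reflexive (≡.sym 0≡b)

  gP̄-start-≢ : ∀ {k} → k ≢ b → gP̄ 0 k ≈ 0#
  gP̄-start-≢ {k} k≢b with ℕ.m≤n⇒m<n∨m≡n (z≤n {b})
  ... | inj₁ 0<b = reflexive (gP̄-low-≢ 0<b k≢b)
  ... | inj₂ 0≡b with k
  ...   | zero  = ⊥-elim (k≢b 0≡b)
  ...   | suc _ = reflexive (gP̄-high-> (ℕ.≤-reflexive (≡.sym 0≡b)) z<s)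

  gP̄-step-zero : ∀ m → gP̄ (suc m) 0 ≈ gP̄ m 0
  gP̄-step-zero m with ℕ.<-cmp (suc m) b
  ... | tri< m+1<b _ _ = reflexive (≡.trans (gP̄-low 0 m+1<b) (≡.sym (gP̄-low 0 (ℕ.<⇒≤ m+1<b))))
  ... | tri≈ _ m+1≡b _ = reflexive (≡.trans
          (gP̄-high (ℕ.≤-reflexive (≡.sym m+1≡b)) z≤n (ℕ.m≤n⇒m∸n≡0 (ℕ.≤-reflexive m+1≡b)) ≡.refl)
          (≡.sym (gP̄-low-≢ (ℕ.≤-reflexive m+1≡b) (λ 0≡b → ℕ.0≢1+n (≡.trans 0≡b (≡.sym m+1≡b))))))
  ... | tri> _ _ (s≤s b≤m) = begin
          gP̄ (suc m) 0       ≡⟨ gP̄-high (ℕ.m≤n⇒m≤1+n b≤m) z≤n (ℕ.+-∸-assoc 1 b≤m) ≡.refl ⟩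
          c (suc (m ∸ b)) (suc m) ≈⟨ catalan-shift (ℕ.m∸n≤m m b) ⟩
          c (m ∸ b) m        ≡⟨ ≡.sym (gP̄-high b≤m z≤n ≡.refl ≡.refl) ⟩
          gP̄ m 0             ∎

  gP̄-step-above : ∀ {m k} → suc m < k → gP̄ (suc m) k ≈ gP̄ m k
  gP̄-step-above {m} {k} m+1<k with ℕ.<-cmp (suc m) b
  ... | tri< m+1<b _ _ = reflexive (≡.trans (gP̄-low k m+1<b) (≡.sym (gP̄-low k (ℕ.<⇒≤ m+1<b))))
  ... | tri≈ _ m+1≡b _ = reflexive (≡.trans (gP̄-high-> (ℕ.≤-reflexive (≡.sym m+1≡b)) m+1<k)
          (≡.sym (gP̄-low-≢ (ℕ.≤-reflexive m+1≡b) (ℕ.<⇒≢ m+1<k ∘ ≡.trans m+1≡b ∘ ≡.sym))))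
  ... | tri> _ _ (s≤s b≤m) = reflexive (≡.trans (gP̄-high-> (ℕ.m≤n⇒m≤1+n b≤m) m+1<k)
          (≡.sym (gP̄-high-> b≤m (ℕ.<-trans (ℕ.n<1+n m) m+1<k))))

  private
    gP̄-step-low : ∀ {m k} → m < b → k ≤ m → gP̄ (suc m) (suc k) ≈ gP̄ m (suc k) →
                  gP̄ (suc m) (suc k) ≈ gP̄ m (suc k) + s (m ∸ k) * gP̄ m k + gP̄-down m k
    gP̄-step-low {m} {k} m<b k≤m first = begin
      gP̄ (suc m) (suc k)                                ≈⟨ trans first (sym (+-identityʳ _)) ⟩
      gP̄ m (suc k) + 0#                                 ≈⟨ +-congˡ (sym (low-terms-vanish m<b k≤m (s (m ∸ k)))) ⟩
      gP̄ m (suc k) + (s (m ∸ k) * gP̄ m k + gP̄-down m k) ≈⟨ sym (+-assoc _ _ _) ⟩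
      gP̄ m (suc k) + s (m ∸ k) * gP̄ m k + gP̄-down m k   ∎

    gP̄-step-diagonal : ∀ {m} → b ≤ m → gP̄ (suc m) (suc m) ≈ gP̄ m (suc m) + s (m ∸ m) * gP̄ m m + gP̄-down m m
    gP̄-step-diagonal {m} b≤m = begin
      gP̄ (suc m) (suc m)
        ≡⟨ gP̄-high (ℕ.m≤n⇒m≤1+n b≤m) ℕ.≤-refl (ℕ.+-∸-assoc 1 b≤m) (ℕ.n∸n≡0 m) ⟩
      s 0 * c N 0 + t 1 * c N 1
        ≈⟨ +-cong (sym (+-identityˡ _)) (sym (down m b≤m)) ⟩
      0# + s 0 * c N 0 + gP̄-down m m
        ≡⟨ ≡.cong₂ _+_ (≡.cong₂ _+_ (≡.sym (gP̄-high-> b≤m (ℕ.n<1+n m)))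
                                   (≡.cong₂ _*_ (cong s (≡.sym (ℕ.n∸n≡0 m)))
                                                (≡.sym (gP̄-high b≤m ℕ.≤-refl ≡.refl (ℕ.n∸n≡0 m)))))
                       ≡.refl ⟩
      gP̄ m (suc m) + s (m ∸ m) * gP̄ m m + gP̄-down m m ∎
      where
      N = m ∸ b
      down : ∀ m → b ≤ m → gP̄-down m m ≈ t 1 * c (m ∸ b) 1
      down zero     _   = sym (*-above-diagonal (t 1) (s≤s (ℕ.m∸n≤m 0 b)))
      down (suc m′) b≤m = reflexive (≡.cong₂ _*_ (cong t (ℕ.m+n∸n≡m 1 m′))
                                                 (gP̄-high b≤m (ℕ.n≤1+n m′) ≡.refl (ℕ.m+n∸n≡m 1 m′)))

    gP̄-step-below : ∀ {m k} → b ≤ m → k < m →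
                    gP̄ (suc m) (suc k) ≈ gP̄ m (suc k) + s (m ∸ k) * gP̄ m k + gP̄-down m k
    gP̄-step-below {m} {k} b≤m k<m = begin
      gP̄ (suc m) (suc k)
        ≡⟨ gP̄-high (ℕ.m≤n⇒m≤1+n b≤m) (s≤s (ℕ.<⇒≤ k<m)) (ℕ.+-∸-assoc 1 b≤m) (∸-suc k<m) ⟩
      1# * c N h + s (suc h) * c N (suc h) + t (suc (suc h)) * c N (suc (suc h))
        ≈⟨ +-cong (+-congʳ (*-identityˡ _)) (sym (down k k<m)) ⟩
      c N h + s (suc h) * c N (suc h) + gP̄-down m k
        ≡⟨ ≡.cong₂ _+_ (≡.cong₂ _+_ (≡.sym (gP̄-high b≤m k<m ≡.refl ≡.refl))
                                   (≡.cong₂ _*_ (cong s (≡.sym (∸-suc k<m)))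
                                                (≡.sym (gP̄-high b≤m (ℕ.<⇒≤ k<m) ≡.refl (∸-suc k<m)))))
                       ≡.refl ⟩
      gP̄ m (suc k) + s (m ∸ k) * gP̄ m k + gP̄-down m k ∎
      where
      N = m ∸ b
      h = m ∸ suc k
      down : ∀ k → k < m → gP̄-down m k ≈ t (suc (suc (m ∸ suc k))) * c N (suc (suc (m ∸ suc k)))
      down zero     0<m   =
        sym (*-above-diagonal _ (ℕ.<-≤-trans (s≤s (ℕ.m∸n≤m m b)) (ℕ.≤-reflexive (cong suc (∸-suc 0<m)))))
      down (suc k′) k+1<m = reflexive (≡.cong₂ _*_ (cong t m∸k′)
                                                   (gP̄-high b≤m (ℕ.<⇒≤ (ℕ.<-trans (ℕ.n<1+n k′) k+1<m)) ≡.refl m∸k′))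
        where
        m∸k′ : m ∸ k′ ≡ suc (suc (m ∸ suc (suc k′)))
        m∸k′ = ≡.trans (∸-suc (ℕ.<-trans (ℕ.n<1+n k′) k+1<m)) (cong suc (∸-suc k+1<m))

  gP̄-step : ∀ {m k} → k ≤ m → gP̄ (suc m) (suc k) ≈ gP̄ m (suc k) + s (m ∸ k) * gP̄ m k + gP̄-down m k
  gP̄-step {m} {k} k≤m with ℕ.<-cmp (suc m) b
  ... | tri< m+1<b _ _ = gP̄-step-low (ℕ.<⇒≤ m+1<b) k≤m (reflexive (≡.trans
          (gP̄-low-≢ m+1<b (ℕ.<⇒≢ (ℕ.≤-<-trans (s≤s k≤m) m+1<b)))
          (≡.sym (gP̄-low-≢ (ℕ.<⇒≤ m+1<b) (ℕ.<⇒≢ (ℕ.≤-<-trans (s≤s k≤m) m+1<b))))))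
  ... | tri≈ _ m+1≡b _ = gP̄-step-low (ℕ.≤-reflexive m+1≡b) k≤m (reflexive (≡.trans
          (gP̄-high (ℕ.≤-reflexive (≡.sym m+1≡b)) (s≤s k≤m) (ℕ.m≤n⇒m∸n≡0 (ℕ.≤-reflexive m+1≡b)) ≡.refl)
          (≡.sym (≡.trans (gP̄-low (suc k) (ℕ.≤-reflexive m+1≡b)) (onTarget k≤m)))))
    where
    onTarget : ∀ {k} → k ≤ m → (if suc k ≡ᵇ b then 1# else 0#) ≡ c 0 (m ∸ k)
    onTarget {k} k≤m with ℕ.m≤n⇒m<n∨m≡n k≤m
    ... | inj₂ ≡.refl rewrite ≡.sym m+1≡b | ≡ᵇ-true k | ℕ.n∸n≡0 k = ≡.refl
    ... | inj₁ k<m    rewrite ≡ᵇ-false (ℕ.<⇒≢ (s≤s k<m) ∘ (λ k+1≡b → ≡.trans k+1≡b (≡.sym m+1≡b)))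
                            | ∸-suc k<m = ≡.refl
  ... | tri> _ _ (s≤s b≤m) with ℕ.m≤n⇒m<n∨m≡n k≤m
  ...   | inj₂ ≡.refl = gP̄-step-diagonal b≤m
  ...   | inj₁ k<m    = gP̄-step-below b≤m k<m

module Balance {a ℓ} (R : CommutativeRing a ℓ) (s t : ℕ → CommutativeRing.Carrier R) (n : ℕ)
               (ty : ℕ → CS.BlockType R) (applicable : ∀ m → m < n → CS.Applicable R s t (ty m))
               (j : ℕ) (j≤n : j ≤ n) where
  open CommutativeRing R
  open CS R
  open Weights s t
  open WalkSums R
  open BlockWeights R s t
  open TildeDigraph R s t n ty
  open Potentials R s t n j j≤n
  open SemiringSolver commutativeSemiring using (solve; _:=_; _:+_; _:*_)
  open import Relation.Binary.Reasoning.Setoid setoid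

  gQ : ℕ → ℕ → Carrier
  gQ m k = gP (suc m) k + (if k ≤ᵇ m then wQP' (ty m) m k * gP (suc m) (suc k) else 0#)

  gQ̄ : ℕ → ℕ → Carrier
  gQ̄ m zero    = gP̄ m 0
  gQ̄ m (suc k) = gP̄ m (suc k) + wPQ' (ty m) m k * gP̄ m k

  potential : VT → Carrier
  potential (orig (P m k)) = gP m k
  potential (orig (Q m k)) = gQ m k
  potential (bar  (P m k)) = gP̄ m k
  potential (bar  (Q m k)) = gQ̄ m k

  open OutSums potential

  private
    level : ∀ {m k} → m < n → k ≤ m → wQP' (ty m) m k + wPQ' (ty m) m k + wPP (ty m) m k ≈ s (m ∸ k)
    level {m} m<n = level-step-weight (ty m) (applicable m m<n)

    down : ∀ {m k} → m < n → k < m → wPQ' (ty m) m k * wQP' (ty m) m (suc k) ≈ t (m ∸ k)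
    down {m} m<n = down-step-weight (ty m) (applicable m m<n)

    gQ-≤ : ∀ {m k} → k ≤ m → gQ m k ≡ gP (suc m) k + wQP' (ty m) m k * gP (suc m) (suc k)
    gQ-≤ k≤m rewrite ≤ᵇ-true k≤m = ≡.refl

    gQ-edge : ∀ m → gQ m (suc m) ≈ gP (suc m) (suc m)
    gQ-edge m rewrite ≤ᵇ-false (ℕ.n<1+n m) = +-identityʳ _

  balance-P-below : ∀ {m k} → m < n → k < m → gP m k ≈ outSum D̃ potential (orig (P m k))
  balance-P-below {m} {k} m<n k<m = sym (begin
    outSum D̃ potential (orig (P m k))
      ≈⟨ out-P m<n (ℕ.<⇒≤ k<m) ⟩
    wPQ (ty m) m k * gQ m k + (p * gQ m (suc k) + w * X₂)
      ≈⟨ +-congʳ (trans (*-congʳ (wPQ≈1 (ty m) m k)) (*-identityˡ _)) ⟩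
    gQ m k + (p * gQ m (suc k) + w * X₂)
      ≡⟨ ≡.cong₂ (λ x y → x + (p * y + w * X₂)) (gQ-≤ (ℕ.<⇒≤ k<m)) (gQ-≤ k<m) ⟩
    X₁ + q * X₂ + (p * (X₂ + q′ * X₃) + w * X₂)
      ≈⟨ solve 7 (λ X₁ X₂ X₃ q p q′ w → X₁ :+ q :* X₂ :+ (p :* (X₂ :+ q′ :* X₃) :+ w :* X₂)
                                     := X₁ :+ (q :+ p :+ w) :* X₂ :+ (p :* q′) :* X₃) refl X₁ X₂ X₃ q p q′ w ⟩
    X₁ + (q + p + w) * X₂ + (p * q′) * X₃
      ≈⟨ +-cong (+-congˡ (*-congʳ (level m<n (ℕ.<⇒≤ k<m)))) (*-congʳ (down m<n k<m)) ⟩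
    X₁ + s (m ∸ k) * X₂ + t (m ∸ k) * X₃
      ≈⟨ sym (gP-below-diagonal m<n k<m) ⟩
    gP m k ∎)
    where
    X₁ = gP (suc m) k
    X₂ = gP (suc m) (suc k)
    X₃ = gP (suc m) (suc (suc k))
    q = wQP' (ty m) m k
    p = wPQ' (ty m) m k
    q′ = wQP' (ty m) m (suc k)
    w = wPP (ty m) m k

  balance-P-diagonal : ∀ {m} → m < n → gP m m ≈ outSum D̃ potential (orig (P m m))
  balance-P-diagonal {m} m<n = sym (begin
    outSum D̃ potential (orig (P m m))
      ≈⟨ out-P m<n ℕ.≤-refl ⟩
    wPQ (ty m) m m * gQ m m + (p * gQ m (suc m) + w * X₂)
      ≈⟨ +-cong (trans (*-congʳ (wPQ≈1 (ty m) m m)) (*-identityˡ _)) (+-congʳ (*-congˡ (gQ-edge m))) ⟩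
    gQ m m + (p * X₂ + w * X₂)
      ≡⟨ cong (_+ (p * X₂ + w * X₂)) (gQ-≤ ℕ.≤-refl) ⟩
    X₁ + q * X₂ + (p * X₂ + w * X₂)
      ≈⟨ solve 5 (λ X₁ X₂ q p w → X₁ :+ q :* X₂ :+ (p :* X₂ :+ w :* X₂) := X₁ :+ (q :+ p :+ w) :* X₂)
               refl X₁ X₂ q p w ⟩
    X₁ + (q + p + w) * X₂
      ≈⟨ +-congˡ (*-congʳ (trans (level m<n ℕ.≤-refl) (reflexive (cong s (ℕ.n∸n≡0 m))))) ⟩
    X₁ + s 0 * X₂
      ≈⟨ sym (gP-diagonal m<n) ⟩
    gP m m ∎)
    where
    X₁ = gP (suc m) m
    X₂ = gP (suc m) (suc m)
    q = wQP' (ty m) m m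
    p = wPQ' (ty m) m m
    w = wPP (ty m) m m

  balance-P-edge : ∀ {m} → m < n → gP m (suc m) ≈ outSum D̃ potential (orig (P m (suc m)))
  balance-P-edge {m} m<n = sym (begin
    outSum D̃ potential (orig (P m (suc m)))  ≈⟨ out-P-edge m<n ⟩
    wPQ (ty m) m (suc m) * gQ m (suc m)       ≈⟨ trans (*-congʳ (wPQ≈1 (ty m) m (suc m))) (*-identityˡ _) ⟩
    gQ m (suc m)                              ≈⟨ gQ-edge m ⟩
    gP (suc m) (suc m)                        ≡⟨ ≡.sym (gP-above-diagonal (ℕ.n<1+n m)) ⟩
    gP m (suc m)                              ∎)

  balance-P : ∀ {m k} → m < n → k ≤ n → gP m k ≈ outSum D̃ potential (orig (P m k))
  balance-P {m} {k} m<n k≤n with ℕ.<-cmp k m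
  ... | tri< k<m _ _    = balance-P-below m<n k<m
  ... | tri≈ _ ≡.refl _ = balance-P-diagonal m<n
  ... | tri> _ _ m<k with ℕ.m≤n⇒m<n∨m≡n m<k
  ...   | inj₂ ≡.refl = balance-P-edge m<n
  ...   | inj₁ m+1<k  = trans (reflexive (gP-above-diagonal m<k)) (sym (out-P-conn m<n m+1<k k≤n))

  balance-P-top : ∀ {k} → k ≤ n → gP n k ≈ outSum D̃ potential (orig (P n k))
  balance-P-top {k} k≤n = sym (trans (out-P-top k≤n)
    (reflexive (≡.trans (cong (tprod (n ∸ k) *_) (gP̄-top k≤n)) (≡.sym (gP-top k≤n)))))

  balance-Q : ∀ {m k} → m < n → k ≤ suc m → gQ m k ≈ outSum D̃ potential (orig (Q m k))
  balance-Q {m} {k} m<n k≤m+1 with ℕ.m≤n⇒m<n∨m≡n k≤m+1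
  ... | inj₁ (s≤s k≤m) = sym (trans (out-Q m<n k≤m)
          (trans (+-congʳ (trans (*-congʳ (wQP≈1 (ty m) m k)) (*-identityˡ _))) (reflexive (≡.sym (gQ-≤ k≤m)))))
  ... | inj₂ ≡.refl = sym (trans (out-Q-edge m<n)
          (trans (trans (*-congʳ (wQP≈1 (ty m) m (suc m))) (*-identityˡ _)) (sym (gQ-edge m))))

  balance-Q̄ : ∀ {m k} → m < n → k ≤ suc m → gQ̄ m k ≈ outSum D̃ potential (bar (Q m k))
  balance-Q̄ {m} {zero}  m<n _ = sym (trans (out-Q̄-zero m<n) (trans (*-congʳ (wPQ≈1 (ty m) m 0)) (*-identityˡ _)))
  balance-Q̄ {m} {suc k} m<n (s≤s k≤m) =
    sym (trans (out-Q̄-suc m<n k≤m) (+-congʳ (trans (*-congʳ (wPQ≈1 (ty m) m (suc k))) (*-identityˡ _))))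

  private
    wQP'-gQ̄ : ∀ {m k} → m < n → k ≤ m → wQP' (ty m) m k * gQ̄ m k ≈ wQP' (ty m) m k * gP̄ m k + gP̄-down m k
    wQP'-gQ̄ {m} {zero}  m<n _     = sym (+-identityʳ _)
    wQP'-gQ̄ {m} {suc k} m<n k+1≤m = begin
      q * (gP̄ m (suc k) + p * gP̄ m k)
        ≈⟨ distribˡ q _ _ ⟩
      q * gP̄ m (suc k) + q * (p * gP̄ m k)
        ≈⟨ +-congˡ (trans (sym (*-assoc q p _)) (*-congʳ (trans (*-comm q p) (down m<n k+1≤m)))) ⟩
      q * gP̄ m (suc k) + t (m ∸ k) * gP̄ m k ∎
      where
      q = wQP' (ty m) m (suc k)
      p = wPQ' (ty m) m k

  balance-P̄ : ∀ {m k} → m < n → k ≤ n → gP̄ (suc m) k ≈ outSum D̃ potential (bar (P (suc m) k))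
  balance-P̄ {m} {zero} m<n _ = sym (begin
    outSum D̃ potential (bar (P (suc m) 0))  ≈⟨ out-P̄-zero m<n ⟩
    wQP (ty m) m 0 * gP̄ m 0                    ≈⟨ trans (*-congʳ (wQP≈1 (ty m) m 0)) (*-identityˡ _) ⟩
    gP̄ m 0                                     ≈⟨ sym (gP̄-step-zero m) ⟩
    gP̄ (suc m) 0                               ∎)
  balance-P̄ {m} {suc k} m<n k+1≤n with ℕ.≤-<-connex k m
  ... | inj₁ k≤m = sym (begin
    outSum D̃ potential (bar (P (suc m) (suc k)))
      ≈⟨ out-P̄-suc m<n k≤m ⟩
    wQP (ty m) m (suc k) * gQ̄ m (suc k) + (q * gQ̄ m k + w * Y₀)
      ≈⟨ +-cong (trans (*-congʳ (wQP≈1 (ty m) m (suc k))) (*-identityˡ _)) (+-congʳ (wQP'-gQ̄ m<n k≤m)) ⟩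
    Y₁ + p * Y₀ + (q * Y₀ + gP̄-down m k + w * Y₀)
      ≈⟨ solve 6 (λ Y₁ Y₀ D p q w → Y₁ :+ p :* Y₀ :+ (q :* Y₀ :+ D :+ w :* Y₀)
                                   := Y₁ :+ (q :+ p :+ w) :* Y₀ :+ D)
               refl Y₁ Y₀ (gP̄-down m k) p q w ⟩
    Y₁ + (q + p + w) * Y₀ + gP̄-down m k
      ≈⟨ +-congʳ (+-congˡ (*-congʳ (level m<n k≤m))) ⟩
    Y₁ + s (m ∸ k) * Y₀ + gP̄-down m k
      ≈⟨ sym (gP̄-step k≤m) ⟩
    gP̄ (suc m) (suc k) ∎)
    where
    Y₀ = gP̄ m k
    Y₁ = gP̄ m (suc k)
    p = wPQ' (ty m) m k
    q = wQP' (ty m) m k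
    w = wPP (ty m) m k
  ... | inj₂ m<k = trans (gP̄-step-above (s≤s m<k)) (sym (out-P̄-conn m<n (s≤s m<k) k+1≤n))

  private
    away : ∀ {u} → u ≢ bar (P 0 b) → potential u ≈ outSum D̃ potential u →
           potential u ≈ walkSum D̃ 0 u (bar (P 0 b)) + outSum D̃ potential u
    away {u} u≢v balanced =
      trans balanced (sym (trans (+-congʳ (walkSum-≢ D̃ u (bar (P 0 b)) u≢v)) (+-identityˡ _)))

  balance : ∀ u → Vertex u → potential u ≈ walkSum D̃ 0 u (bar (P 0 b)) + outSum D̃ potential u
  balance (orig (P m k)) (m≤n , k≤n) with ℕ.m≤n⇒m<n∨m≡n m≤n
  ... | inj₁ m<n    = away (λ ()) (balance-P m<n k≤n)
  ... | inj₂ ≡.refl = away (λ ()) (balance-P-top k≤n)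
  balance (orig (Q m k))       (m<n , k≤m+1) = away (λ ()) (balance-Q m<n k≤m+1)
  balance (bar (P zero k))     _             =
    trans (source (k ℕ.≟ b)) (sym (trans (+-congˡ out-P̄-bottom) (+-identityʳ _)))
    where
    source : ∀ {k} → Dec (k ≡ b) → gP̄ 0 k ≈ walkSum D̃ 0 (bar (P 0 k)) (bar (P 0 b))
    source (yes ≡.refl) = trans gP̄-start-b (sym (walkSum-refl D̃ (bar (P 0 b))))
    source {k} (no k≢b) =
      trans (gP̄-start-≢ k≢b) (sym (walkSum-≢ D̃ (bar (P 0 k)) (bar (P 0 b)) (k≢b ∘ cong subscript)))
  balance (bar (P (suc m) k))  (m<n , k≤n)   = away (λ ()) (balance-P̄ m<n k≤n)
  balance (bar (Q m k))        (m<n , k≤m+1) = away (λ ()) (balance-Q̄ m<n k≤m+1)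

corollary2p5 : ∀ {a ℓ} (R : CommutativeRing a ℓ) → 
  let open CommutativeRing R
      open CS R
  in
  (s t : ℕ → Carrier) (n : ℕ) → 1 ≤ n →
  (ty : ℕ → BlockType) → (∀ m → m < n → Applicable s t (ty m)) →
  ∀ i j → i ≤ n → j ≤ n →
  catalan s t (i +ℕ j) 0
    ≈ GF (Weights.tildeArcs s t n ty) (orig (P 0 (n ∸ i))) (bar (P 0 (n ∸ j)))
corollary2p5 R s t n _ ty applicable i j i≤n j≤n = begin
  c (i +ℕ j) 0                     ≡⟨ cong (λ N → c (N +ℕ j) 0) (≡.sym (ℕ.m∸[m∸n]≡n i≤n)) ⟩
  c (n ∸ (n ∸ i) +ℕ j) 0           ≈⟨ sym (*-identityˡ _) ⟩
  ĉ (n ∸ (n ∸ i) +ℕ j) 0           ≡⟨ ≡.sym (gP-start (n ∸ i)) ⟩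
  gP 0 (n ∸ i)                     ≈⟨ sym (GF≈solution D̃ (bar (P 0 b)) rank Vertex descends potential balance
                                            (orig (P 0 (n ∸ i))) (z≤n , ℕ.m∸n≤m n i) (rank≤length (n ∸ i))) ⟩
  GF D̃ (orig (P 0 (n ∸ i))) (bar (P 0 b)) ∎
  where
  open CommutativeRing R
  open CS R
  open WalkSums R
  open CatalanMatrix R s t
  open TildeDigraph R s t n ty
  open Potentials R s t n j j≤n
  open Balance R s t n ty applicable j j≤n
  open import Relation.Binary.Reasoning.Setoid setoid
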